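{- For every integer $b\ge1$, the poset $N_{1,b,1}$ is LE-symmetric.
   Context: For integers $a,b,c\ge1$, $N_{a,b,c}$ is the poset on elements $v_1,\dots,v_{a+b+c+1}$ whose order is generated by the relations $v_1<v_2<\dots<v_{a+1}>v_{a+2}>\dots>v_{a+b+1}<v_{a+b+2}<\dots<v_{a+b+c+1}$; thus $N_{1,b,1}$ has $b+3$ elements with $v_1<v_2>v_3>\dots>v_{b+2}<v_{b+3}$. For an $n$-element poset $P$, a linear extension is a list $(p_1,\dots,p_n)$ of all elements with $p_a<_P p_b$ implying $a<b$; ${\mathcal{L}}(P)$ is the set of these. The Bender--Knuth move $t_i$ ($1\le i\le n-1$) acts on ${\mathcal{L}}(P)$ by swapping $p_i,p_{i+1}$ if incomparable and fixing the list otherwise; $\mathcal{BK}_P\le{\mathfrak{S}}_{{\mathcal{L}}(P)}$ is the group they generate. $P$ is LE-symmetric if $\mathcal{BK}_P={\mathfrak{S}}_{{\mathcal{L}}(P)}$. -}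

module Defs where

open import Data.Nat using (ℕ; suc; _+_; _≤_; _<_)
open import Data.Fin using (Fin; toℕ; inject₁) renaming (suc to fsuc; _<_ to _<ꟳ_)
open import Data.Vec using (Vec; lookup; _[_]≔_)
open import Data.Vec.Membership.Propositional using (_∈_)
open import Data.List using (List; []; _∷_)
open import Data.Product using (Σ; ∃; _×_; proj₁)
open import Data.Sum using (_⊎_)
open import Relation.Nullary using (¬_)
open import Relation.Binary.PropositionalEquality using (_≡_)
open import Relation.Binary.Construct.Closure.Transitive using (TransClosure)

-- A finite poset on the carrier Fin n is given by its strict order relation _<P_.

record IsLinExt {n : ℕ} (_<P_ : Fin n → Fin n → Set) (p : Vec (Fin n) n) : Set where
  field
    covers   : ∀ x → x ∈ p
    distinct : ∀ i j → lookup p i ≡ lookup p j → i ≡ j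
    ordered  : ∀ i j → lookup p i <P lookup p j → i <ꟳ j

LinExt : {n : ℕ} → (Fin n → Fin n → Set) → Set
LinExt {n} _<P_ = Σ (Vec (Fin n) n) (IsLinExt _<P_)

Comparable : {n : ℕ} → (Fin n → Fin n → Set) → Fin n → Fin n → Set
Comparable _<P_ x y = x ≡ y ⊎ x <P y ⊎ y <P x

swap : {n : ℕ} {A : Set} → Vec A n → Fin n → Fin n → Vec A n
swap p i j = (p [ i ]≔ lookup p j) [ j ]≔ lookup p i

-- Bender–Knuth move t_{i+1} (0-based index i : Fin k, carrier of size n = suc k),
-- given as its graph: it swaps positions i, i+1 (0-based) if the entries are
-- incomparable and fixes the list otherwise.
data BK {k : ℕ} (_<P_ : Fin (suc k) → Fin (suc k) → Set) (i : Fin k)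
        (p : Vec (Fin (suc k)) (suc k)) : Vec (Fin (suc k)) (suc k) → Set where
  bk-swap : ¬ Comparable _<P_ (lookup p (inject₁ i)) (lookup p (fsuc i)) →
            BK _<P_ i p (swap p (inject₁ i) (fsuc i))
  bk-fix  : Comparable _<P_ (lookup p (inject₁ i)) (lookup p (fsuc i)) →
            BK _<P_ i p p

-- Action of a word t_{i₁} t_{i₂} ⋯ t_{i_r} (rightmost applied first) as a relation.
data BKWord {k : ℕ} (_<P_ : Fin (suc k) → Fin (suc k) → Set) :
            List (Fin k) → Vec (Fin (suc k)) (suc k) → Vec (Fin (suc k)) (suc k) → Set where
  w-nil  : ∀ {p} → BKWord _<P_ [] p p
  w-cons : ∀ {i ws p q r} → BKWord _<P_ ws p q → BK _<P_ i q r → BKWord _<P_ (i ∷ ws) p r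

-- Permutations of 𝓛(P) (bijections, with equality of linear extensions = equality of lists).
IsPermLE : {n : ℕ} (_<P_ : Fin n → Fin n → Set) → (LinExt _<P_ → LinExt _<P_) → Set
IsPermLE {n} _<P_ σ =
  (∀ (L L' : LinExt {n} _<P_) → proj₁ (σ L) ≡ proj₁ (σ L') → proj₁ L ≡ proj₁ L') ×
  (∀ (L' : LinExt {n} _<P_) → Σ (LinExt {n} _<P_) (λ L → proj₁ (σ L) ≡ proj₁ L'))

-- LE-symmetric: BK_P = 𝔖_{𝓛(P)}, i.e. every permutation of 𝓛(P) is
-- realised by some word in the Bender–Knuth generators t_i (each t_i is an
-- involution, so the generated group equals the set of such words).
LESymmetric : {k : ℕ} → (Fin (suc k) → Fin (suc k) → Set) → Set
LESymmetric _<P_ =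
  ∀ (σ : LinExt _<P_ → LinExt _<P_) → IsPermLE _<P_ σ →
  ∃ λ ws → ∀ (L : LinExt _<P_) → BKWord _<P_ ws (proj₁ L) (proj₁ (σ L))

-- Covering relations of N_{a,b,c}: element v_{j+1} is represented by j : Fin (a+b+c+1).
-- x ⋖ y means "x < y is one of the generating relations".
NCover : (a b c : ℕ) → Fin (suc (a + b + c)) → Fin (suc (a + b + c)) → Set
NCover a b c x y =
  (suc (toℕ x) ≡ toℕ y × (toℕ y ≤ a ⊎ a + b < toℕ y)) ⊎
  (toℕ x ≡ suc (toℕ y) × a < toℕ x × toℕ x ≤ a + b)

N< : (a b c : ℕ) → Fin (suc (a + b + c)) → Fin (suc (a + b + c)) → Set
N< a b c = TransClosure (NCover a b c)

-- A linear extension of N_{1,b,1} is determined by the positions ⟨ x , y ⟩ of the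
-- elements 0 and b+2, the chain b+1 < ⋯ < 1 filling the other positions in order. On
-- these states the Bender–Knuth move t_i swaps positions i, i+1 if the result is again
-- a state and fixes the state otherwise. Each t_i is an involution and every state is
-- reached from p₀ = ⟨ 0 , 2 ⟩, so conjugating and composing turns the transpositions
-- (t_i p₀ , p₀) into all transpositions of states, and these generate every
-- permutation. Only t₀ p₀ and t₂ p₀ differ from p₀: for b ≥ 3 the word (t₁t₂)³ swaps
-- p₀ with ⟨ 0 , 3 ⟩ and fixes all other states, and conjugating along the chain, together
-- with the anti-automorphism reversing linear extensions, reaches ⟨ 1 , 2 ⟩; for b = 1, 2
-- explicit words are checked by evaluation.

module Submission where

open import Defs
open import Data.Nat using (ℕ; zero; suc; _+_; _∸_; _≤_; _<_; z≤n; s≤s; _≟_; _<?_; _≤?_; _≡ᵇ_; _<ᵇ_)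
open import Data.Nat.Properties
open import Data.Nat.Tactic.RingSolver using (solve-∀)
open import Data.Bool using (Bool; true; false; _∨_; if_then_else_; T)
open import Data.Bool.Properties using (T?; T-irrelevant)
open import Data.Unit using (⊤)
open import Data.Fin as Fin using (Fin; toℕ; inject₁; fromℕ<; punchOut)
open import Data.Fin.Properties
  using (toℕ-injective; toℕ-inject₁; toℕ<n; toℕ-fromℕ<; any?; punchOut-injective; injective⇒≤)
open import Data.Vec using (Vec; lookup; tabulate; _[_]≔_)
open import Data.Vec.Properties using (lookup∘tabulate; lookup∘update; lookup∘update′)
open import Data.Vec.Membership.Propositional using (_∈_)
open import Data.Vec.Membership.Propositional.Properties using (∈-lookup)
import Data.Vec.Relation.Unary.Any as Any
open import Data.Vec.Relation.Unary.Any.Properties using (lookup-index)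
open import Data.Vec.Relation.Binary.Pointwise.Extensional using (ext; Pointwise-≡⇒≡)
open import Data.List using (List; []; _∷_; _++_; _∷ʳ_; foldr; map; reverse; upTo; cartesianProductWith)
open import Data.List.Properties using (foldr-++; unfold-reverse)
open import Data.List.Membership.Propositional using () renaming (_∈_ to _∈ₗ_)
open import Data.List.Membership.Propositional.Properties using (∈-cartesianProductWith⁺; ∈-upTo⁺)
open import Data.List.Relation.Unary.Any using (here; there)
open import Data.List.Relation.Unary.All as All using (all?)
open import Data.Product using (∃-syntax; _×_; _,_; proj₁; proj₂)
open import Data.Sum using (_⊎_; inj₁; inj₂)
open import Data.Empty using (⊥-elim)
open import Relation.Nullary using (Dec; yes; no; ¬_)
open import Relation.Nullary.Decidable
  using (True; isYes; toWitness; fromWitness; map′; _×-dec_; _⊎-dec_; _→-dec_; ¬?)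
open import Relation.Binary.Definitions using (DecidableEquality; tri<; tri≈; tri>)
open import Relation.Binary.PropositionalEquality
open import Relation.Binary.Construct.Closure.Transitive using ([_]; _∷_)


-- Words in involutions and the transpositions they realize

module InvolutionWords {X G : Set} (_≟_ : DecidableEquality X)
  (Valid : X → Set) (t : G → X → X)
  (t-valid : ∀ i {s} → Valid s → Valid (t i s))
  (t-involutive : ∀ i {s} → Valid s → t i (t i s) ≡ s) where

  act : List G → X → X
  act w s = foldr t s w

  act-++ : ∀ u w s → act (u ++ w) s ≡ act u (act w s)
  act-++ u w s = foldr-++ t s u w

  act-valid : ∀ w {s} → Valid s → Valid (act w s)
  act-valid []      v = v
  act-valid (i ∷ w) v = t-valid i (act-valid w v)

  t-injective : ∀ i {s s'} → Valid s → Valid s' → t i s ≡ t i s' → s ≡ s'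
  t-injective i {s} {s'} v v' e =
    trans (sym (t-involutive i v)) (trans (cong (t i) e) (t-involutive i v'))

  act-injective : ∀ w {s s'} → Valid s → Valid s' → act w s ≡ act w s' → s ≡ s'
  act-injective []      v v' e = e
  act-injective (i ∷ w) v v' e =
    act-injective w v v' (t-injective i (act-valid w v) (act-valid w v') e)

  act-reverse : ∀ w {s} → Valid s → act w (act (reverse w) s) ≡ s
  act-reverse []      v = refl
  act-reverse (i ∷ w) {s} v = begin
    t i (act w (act (reverse (i ∷ w)) s))  ≡⟨ cong (λ u → t i (act w (act u s))) (unfold-reverse i w) ⟩
    t i (act w (act (reverse w ∷ʳ i) s))   ≡⟨ cong (λ z → t i (act w z)) (act-++ (reverse w) (i ∷ []) s) ⟩
    t i (act w (act (reverse w) (t i s)))  ≡⟨ cong (t i) (act-reverse w (t-valid i v)) ⟩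
    t i (t i s)                            ≡⟨ t-involutive i v ⟩
    s                                      ∎
    where open ≡-Reasoning

  Realizes : List G → (X → X) → Set
  Realizes w f = ∀ s → Valid s → act w s ≡ f s

  exchange : X → X → X → X
  exchange a c s with s ≟ a
  ... | yes _ = c
  ... | no _ with s ≟ c
  ...   | yes _ = a
  ...   | no _  = s

  exchange-left : ∀ a c → exchange a c a ≡ c
  exchange-left a c with a ≟ a
  ... | yes _ = refl
  ... | no a≢a = ⊥-elim (a≢a refl)

  exchange-right : ∀ a c → exchange a c c ≡ a
  exchange-right a c with c ≟ a
  ... | yes c≡a = c≡a
  ... | no _ with c ≟ c
  ...   | yes _ = refl
  ...   | no c≢c = ⊥-elim (c≢c refl)

  exchange-other : ∀ {a c s} → s ≢ a → s ≢ c → exchange a c s ≡ s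
  exchange-other {a} {c} {s} s≢a s≢c with s ≟ a
  ... | yes s≡a = ⊥-elim (s≢a s≡a)
  ... | no _ with s ≟ c
  ...   | yes s≡c = ⊥-elim (s≢c s≡c)
  ...   | no _    = refl

  data ExchangeView (a c s : X) : Set where
    at-left  : s ≡ a → ExchangeView a c s
    at-right : s ≡ c → ExchangeView a c s
    away     : s ≢ a → s ≢ c → ExchangeView a c s

  exchange-view : ∀ a c s → ExchangeView a c s
  exchange-view a c s with s ≟ a | s ≟ c
  ... | yes s≡a | _       = at-left s≡a
  ... | no _    | yes s≡c = at-right s≡c
  ... | no s≢a  | no s≢c  = away s≢a s≢c

  exchange-comm : ∀ a c s → exchange a c s ≡ exchange c a s
  exchange-comm a c s with exchange-view a c s
  ... | at-left refl  = trans (exchange-left s c) (sym (exchange-right c s))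
  ... | at-right refl = trans (exchange-right a s) (sym (exchange-left s a))
  ... | away s≢a s≢c  = trans (exchange-other s≢a s≢c) (sym (exchange-other s≢c s≢a))

  exchange-valid : ∀ {a c s} → Valid a → Valid c → Valid s → Valid (exchange a c s)
  exchange-valid {a} {c} {s} va vc vs with exchange-view a c s
  ... | at-left refl  = subst Valid (sym (exchange-left s c)) vc
  ... | at-right refl = subst Valid (sym (exchange-right a s)) va
  ... | away s≢a s≢c  = subst Valid (sym (exchange-other s≢a s≢c)) vs

  exchange-conjugate : (φ : X → X) → ∀ {a c s} → φ (φ a) ≡ a → φ (φ c) ≡ c → φ (φ s) ≡ s →
                       φ (exchange a c (φ s)) ≡ exchange (φ a) (φ c) s
  exchange-conjugate φ {a} {c} {s} φφa φφc φφs with exchange-view a c (φ s)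
  ... | at-left φs≡a =
    trans (cong (λ z → φ (exchange a c z)) φs≡a)
          (trans (cong φ (exchange-left a c))
                 (sym (trans (cong (exchange (φ a) (φ c)) s≡φa) (exchange-left (φ a) (φ c)))))
    where s≡φa = trans (sym φφs) (cong φ φs≡a)
  ... | at-right φs≡c =
    trans (cong (λ z → φ (exchange a c z)) φs≡c)
          (trans (cong φ (exchange-right a c))
                 (sym (trans (cong (exchange (φ a) (φ c)) s≡φc) (exchange-right (φ a) (φ c)))))
    where s≡φc = trans (sym φφs) (cong φ φs≡c)
  ... | away φs≢a φs≢c =
    trans (cong φ (exchange-other φs≢a φs≢c))
          (trans φφs (sym (exchange-other (λ e → φs≢a (trans (cong φ e) φφa))
                                          (λ e → φs≢c (trans (cong φ e) φφc)))))

  exchange-involutive : ∀ a c s → exchange a c (exchange a c s) ≡ s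
  exchange-involutive a c s with exchange-view a c s
  ... | at-left refl  = trans (cong (exchange s c) (exchange-left s c)) (exchange-right s c)
  ... | at-right refl = trans (cong (exchange a s) (exchange-right a s)) (exchange-left a s)
  ... | away s≢a s≢c  = trans (cong (exchange a c) (exchange-other s≢a s≢c)) (exchange-other s≢a s≢c)

  exchange-self : ∀ a s → exchange a a s ≡ s
  exchange-self a s with exchange-view a a s
  ... | at-left refl  = exchange-left s s
  ... | at-right refl = exchange-left s s
  ... | away s≢a _    = exchange-other s≢a s≢a

  Transposable : X → X → Set
  Transposable a c = ∃[ w ] Realizes w (exchange a c)

  transposable-refl : ∀ a → Transposable a a
  transposable-refl a = [] , λ s _ → sym (exchange-self a s)

  transposable-sym : ∀ {a c} → Transposable a c → Transposable c a
  transposable-sym {a} {c} (w , h) = w , λ s v → trans (h s v) (exchange-comm a c s)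

  -- ψ need not be induced by a word; μ transports words along it.
  transposable-conjugate : (ψ : X → X) (μ : List G → List G) →
    (∀ {s} → Valid s → Valid (ψ s)) → (∀ {s} → Valid s → ψ (ψ s) ≡ s) →
    (∀ w {s} → Valid s → act (μ w) (ψ s) ≡ ψ (act w s)) →
    ∀ {a c} → Valid a → Valid c → Transposable a c → Transposable (ψ a) (ψ c)
  transposable-conjugate ψ μ ψ-valid ψ-involutive μ-act {a} {c} va vc (w , h) = μ w , realizes
    where
    realizes : Realizes (μ w) (exchange (ψ a) (ψ c))
    realizes s v = begin
      act (μ w) s                  ≡⟨ cong (act (μ w)) (sym (ψ-involutive v)) ⟩
      act (μ w) (ψ (ψ s))          ≡⟨ μ-act w (ψ-valid v) ⟩
      ψ (act w (ψ s))              ≡⟨ cong ψ (h (ψ s) (ψ-valid v)) ⟩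
      ψ (exchange a c (ψ s))       ≡⟨ exchange-conjugate ψ (ψ-involutive va) (ψ-involutive vc) (ψ-involutive v) ⟩
      exchange (ψ a) (ψ c) s      ∎
      where open ≡-Reasoning

  transposable-conjugate-word : ∀ {u ψ} → Realizes u ψ →
    (∀ {s} → Valid s → Valid (ψ s)) → (∀ {s} → Valid s → ψ (ψ s) ≡ s) →
    ∀ {a c} → Valid a → Valid c → Transposable a c → Transposable (ψ a) (ψ c)
  transposable-conjugate-word {u} {ψ} hu ψ-valid ψ-involutive =
    transposable-conjugate ψ (λ w → u ++ w ++ u) ψ-valid ψ-involutive μ-act
    where
    μ-act : ∀ w {s} → Valid s → act (u ++ w ++ u) (ψ s) ≡ ψ (act w s)
    μ-act w {s} v = begin
      act (u ++ w ++ u) (ψ s)        ≡⟨ act-++ u (w ++ u) (ψ s) ⟩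
      act u (act (w ++ u) (ψ s))     ≡⟨ cong (act u) (act-++ w u (ψ s)) ⟩
      act u (act w (act u (ψ s)))    ≡⟨ cong (λ z → act u (act w z)) (trans (hu (ψ s) (ψ-valid v)) (ψ-involutive v)) ⟩
      act u (act w s)                ≡⟨ hu (act w s) (act-valid w v) ⟩
      ψ (act w s)                    ∎
      where open ≡-Reasoning

  transposable-conjugate-t : ∀ i {a c} → Valid a → Valid c → Transposable a c → Transposable (t i a) (t i c)
  transposable-conjugate-t i = transposable-conjugate-word {u = i ∷ []} (λ _ _ → refl) (t-valid i) (t-involutive i)

  -- conjugating (c d) by (a c) gives (a d)
  transposable-trans : ∀ {a c d} → Valid a → Valid c → Valid d →
                       Transposable a c → Transposable c d → Transposable a d
  transposable-trans {a} {c} {d} va vc vd (u , hu) tcd with d ≟ a | d ≟ c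
  ... | yes refl | _        = transposable-refl d
  ... | no _     | yes refl = u , hu
  ... | no d≢a   | no d≢c   =
    subst₂ Transposable (exchange-right a c) (exchange-other d≢a d≢c)
      (transposable-conjugate-word {u = u} hu (exchange-valid va vc) (λ {s} _ → exchange-involutive a c s) vc vd tcd)

  transposable-along : ∀ {p} → Valid p → (∀ i → Transposable (t i p) p) →
                       ∀ w → Transposable (act w p) p
  transposable-along {p} vp base []      = transposable-refl p
  transposable-along {p} vp base (i ∷ w) =
    transposable-trans (t-valid i (act-valid w vp)) (t-valid i vp) vp
      (transposable-conjugate-t i (act-valid w vp) vp (transposable-along vp base w)) (base i)

  transposable-all : ∀ {p} → Valid p → (∀ i → Transposable (t i p) p) →
                     (∀ s → Valid s → ∃[ w ] act w p ≡ s) →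
                     ∀ {a c} → Valid a → Valid c → Transposable a c
  transposable-all {p} vp base reach {a} {c} va vc
    with wa , refl ← reach a va | wc , refl ← reach c vc =
    transposable-trans va vp vc (transposable-along vp base wa)
                       (transposable-sym (transposable-along vp base wc))

  module _ (valid? : ∀ s → Dec (Valid s)) (valid-irrelevant : ∀ {s} (v v' : Valid s) → v ≡ v')
           (transposable : ∀ {a c} → Valid a → Valid c → Transposable a c)
           (f : ∀ s → Valid s → X) (f-valid : ∀ s v → Valid (f s v))
           (f-injective : ∀ {s s'} v v' → f s v ≡ f s' v' → s ≡ s') where

    -- Place the elements of L one at a time: the transposition moving the current image
    -- of e to f e fixes the images already placed, since f and act w are injective.
    realize-on : ∀ L → ∃[ w ] (∀ s → s ∈ₗ L → (v : Valid s) → act w s ≡ f s v)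
    realize-on []      = [] , λ _ ()
    realize-on (e ∷ L) with realize-on L | valid? e
    ... | w , h | no ¬ve = w , λ { s (here refl) v → ⊥-elim (¬ve v) ; s (there s∈L) v → h s s∈L v }
    ... | w , h | yes ve = proj₁ exch ++ w , extended
      where
      u = act w e
      exch = transposable (act-valid w ve) (f-valid e ve)
      collision : ∀ {z} → z ∈ₗ L → (vz : Valid z) → z ≡ e → exchange u (f e ve) (f z vz) ≡ f z vz
      collision z∈L vz refl with refl ← valid-irrelevant vz ve =
        trans (cong (λ a → exchange a (f e ve) (f e ve)) (h e z∈L ve)) (exchange-self (f e ve) (f e ve))
      fixes : ∀ z → z ∈ₗ L → (vz : Valid z) → exchange u (f e ve) (f z vz) ≡ f z vz
      fixes z z∈L vz with exchange-view u (f e ve) (f z vz)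
      ... | away fz≢u fz≢fe = exchange-other fz≢u fz≢fe
      ... | at-left fz≡u    = collision z∈L vz (act-injective w vz ve (trans (h z z∈L vz) fz≡u))
      ... | at-right fz≡fe  = collision z∈L vz (f-injective vz ve fz≡fe)
      extended : ∀ s → s ∈ₗ e ∷ L → (v : Valid s) → act (proj₁ exch ++ w) s ≡ f s v
      extended s s∈ v = trans (act-++ (proj₁ exch) w s) (trans (proj₂ exch (act w s) (act-valid w v)) (at s∈))
        where
        at : s ∈ₗ e ∷ L → exchange u (f e ve) (act w s) ≡ f s v
        at (here refl) = trans (exchange-left u (f e ve)) (cong (f e) (valid-irrelevant ve v))
        at (there s∈L) = trans (cong (exchange u (f e ve)) (h s s∈L v)) (fixes s s∈L v)

-- Adjacent transpositions and linear extensions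

τ : ℕ → ℕ → ℕ
τ zero    zero          = 1
τ zero    (suc zero)    = 0
τ zero    p             = p
τ (suc i) zero          = zero
τ (suc i) (suc p)       = suc (τ i p)

τ-left : ∀ i → τ i i ≡ suc i
τ-left zero    = refl
τ-left (suc i) = cong suc (τ-left i)

τ-right : ∀ i → τ i (suc i) ≡ i
τ-right zero    = refl
τ-right (suc i) = cong suc (τ-right i)

τ-other : ∀ {i p} → p ≢ i → p ≢ suc i → τ i p ≡ p
τ-other {zero}  {zero}              p≢i _  = ⊥-elim (p≢i refl)
τ-other {zero}  {suc zero}          _  p≢1 = ⊥-elim (p≢1 refl)
τ-other {zero}  {suc (suc p)}       _  _   = refl
τ-other {suc i} {zero}              _  _   = refl
τ-other {suc i} {suc p} p≢i p≢si = cong suc (τ-other (λ e → p≢i (cong suc e)) (λ e → p≢si (cong suc e)))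

τ-involutive : ∀ i p → τ i (τ i p) ≡ p
τ-involutive zero    zero             = refl
τ-involutive zero    (suc zero)       = refl
τ-involutive zero    (suc (suc p))    = refl
τ-involutive (suc i) zero             = refl
τ-involutive (suc i) (suc p)          = cong suc (τ-involutive i p)

data TauView (i : ℕ) : ℕ → Set where
  left  : TauView i i
  right : TauView i (suc i)
  other : ∀ {p} → p ≢ i → p ≢ suc i → TauView i p

τ-view : ∀ i p → TauView i p
τ-view i p with p ≟ i | p ≟ suc i
... | yes refl | _        = left
... | no _     | yes refl = right
... | no p≢i   | no p≢si  = other p≢i p≢si

τ-reflects-< : ∀ i {u v} → τ i u < τ i v → ¬ (u ≡ suc i × v ≡ i) → u < v
τ-reflects-< i {u} {v} lt excluded with τ-view i u | τ-view i v
... | left          | left          rewrite τ-left i = ⊥-elim (n≮n _ lt)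
... | left          | right         rewrite τ-left i | τ-right i = ⊥-elim (1+n≰n (≤-trans (n≤1+n _) lt))
... | left          | other v≢i v≢si rewrite τ-left i | τ-other v≢i v≢si = ≤-trans (n≤1+n _) lt
... | right         | left          = ⊥-elim (excluded (refl , refl))
... | right         | right         rewrite τ-right i = ⊥-elim (n≮n _ lt)
... | right         | other v≢i v≢si rewrite τ-right i | τ-other v≢i v≢si = ≤∧≢⇒< lt (λ e → v≢si (sym e))
... | other u≢i u≢si | left         rewrite τ-left i | τ-other u≢i u≢si = ≤∧≢⇒< (≤-pred lt) u≢i
... | other u≢i u≢si | right        rewrite τ-right i | τ-other u≢i u≢si = ≤-trans lt (n≤1+n _)
... | other u≢i u≢si | other v≢i v≢si rewrite τ-other u≢i u≢si | τ-other v≢i v≢si = lt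

injective⇒surjective : ∀ {n} (f : Fin n → Fin n) → (∀ {i j} → f i ≡ f j → i ≡ j) →
                       ∀ y → ∃[ i ] f i ≡ y
injective⇒surjective {suc n} f f-injective y with any? (λ i → f i Fin.≟ y)
... | yes found = found
... | no none = ⊥-elim (1+n≰n (injective⇒≤ g-injective))
  where
  g : Fin (suc n) → Fin n
  g i = punchOut {i = y} (λ e → none (i , sym e))
  g-injective : ∀ {i j} → g i ≡ g j → i ≡ j
  g-injective {i} {j} e = f-injective (punchOut-injective {i = y} (λ e → none (i , sym e)) (λ e → none (j , sym e)) e)

distinct⇒covers : ∀ {n} (p : Vec (Fin n) n) → (∀ i j → lookup p i ≡ lookup p j → i ≡ j) → ∀ x → x ∈ p
distinct⇒covers p distinct x with i , refl ← injective⇒surjective (lookup p) (distinct _ _) x = ∈-lookup i p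

position : ∀ {n} {x} {p : Vec (Fin n) n} → x ∈ p → ∃[ i ] lookup p i ≡ x
position x∈p = Any.index x∈p , sym (lookup-index x∈p)

vec-ext : ∀ {A : Set} {n} {u v : Vec A n} → (∀ k → lookup u k ≡ lookup v k) → u ≡ v
vec-ext h = Pointwise-≡⇒≡ (ext h)

inject₁≢suc : ∀ {k} (i : Fin k) → inject₁ i ≢ Fin.suc i
inject₁≢suc i e = 1+n≰n (≤-trans (≤-reflexive (cong toℕ (sym e))) (≤-reflexive (toℕ-inject₁ i)))

module _ {A : Set} {k : ℕ} (p : Vec A (suc k)) (i : Fin k) where

  private
    L = inject₁ i
    R = Fin.suc i

  swap-adjacent-left : lookup (swap p L R) L ≡ lookup p R
  swap-adjacent-left = trans (lookup∘update′ (inject₁≢suc i) (p [ L ]≔ lookup p R) (lookup p L))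
                             (lookup∘update L p (lookup p R))

  swap-adjacent-right : lookup (swap p L R) R ≡ lookup p L
  swap-adjacent-right = lookup∘update R (p [ L ]≔ lookup p R) (lookup p L)

  swap-adjacent-lookup : ∀ j → ∃[ j' ] toℕ j' ≡ τ (toℕ i) (toℕ j) × lookup (swap p L R) j ≡ lookup p j'
  swap-adjacent-lookup j with j Fin.≟ R | j Fin.≟ L
  ... | yes refl | _ = L , trans (toℕ-inject₁ i) (sym (τ-right (toℕ i))) , swap-adjacent-right
  ... | no _ | yes refl = R , sym (trans (cong (τ (toℕ i)) (toℕ-inject₁ i)) (τ-left (toℕ i))) , swap-adjacent-left
  ... | no j≢R | no j≢L =
    j , sym (τ-other (λ e → j≢L (toℕ-injective (trans e (sym (toℕ-inject₁ i))))) (λ e → j≢R (toℕ-injective e))) ,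
    trans (lookup∘update′ j≢R (p [ L ]≔ lookup p R) (lookup p L)) (lookup∘update′ j≢L p (lookup p R))

τ-injective : ∀ i {u v} → τ i u ≡ τ i v → u ≡ v
τ-injective i {u} {v} e = trans (sym (τ-involutive i u)) (trans (cong (τ i) e) (τ-involutive i v))

module _ {k : ℕ} {_<P_ : Fin (suc k) → Fin (suc k) → Set} {p : Vec (Fin (suc k)) (suc k)} (i : Fin k) where

  private
    L = inject₁ i
    R = Fin.suc i
    q = swap p L R
    R≮L : ¬ (R Fin.< L)
    R≮L lt = 1+n≰n (≤-trans (≤-trans (n≤1+n _) lt) (≤-reflexive (toℕ-inject₁ i)))

  swap-isLinExt : IsLinExt _<P_ p → ¬ Comparable _<P_ (lookup p L) (lookup p R) → IsLinExt _<P_ q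
  swap-isLinExt le incomparable = record
    { covers = distinct⇒covers q distinct′ ; distinct = distinct′ ; ordered = ordered′ }
    where
    open IsLinExt le
    distinct′ : ∀ u v → lookup q u ≡ lookup q v → u ≡ v
    distinct′ u v e
      with u' , tu , qu ← swap-adjacent-lookup p i u | v' , tv , qv ← swap-adjacent-lookup p i v =
      toℕ-injective (τ-injective (toℕ i)
        (trans (sym tu) (trans (cong toℕ (distinct u' v' (trans (sym qu) (trans e qv)))) tv)))
    ordered′ : ∀ u v → lookup q u <P lookup q v → u Fin.< v
    ordered′ u v r
      with u' , tu , qu ← swap-adjacent-lookup p i u | v' , tv , qv ← swap-adjacent-lookup p i v =
      τ-reflects-< (toℕ i) (subst₂ _<_ tu tv (ordered u' v' (subst₂ _<P_ qu qv r))) excluded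
      where
      excluded : ¬ (toℕ u ≡ suc (toℕ i) × toℕ v ≡ toℕ i)
      excluded (eu , ev) with refl ← toℕ-injective {i = u} {j = R} eu
                            | refl ← toℕ-injective {i = v} {j = L} (trans ev (sym (toℕ-inject₁ i))) =
        incomparable (inj₂ (inj₁ (subst₂ _<P_ (swap-adjacent-right p i) (swap-adjacent-left p i) r)))

  swap-isLinExt⇒incomparable : IsLinExt _<P_ p → IsLinExt _<P_ q →
                               ¬ Comparable _<P_ (lookup p L) (lookup p R)
  swap-isLinExt⇒incomparable le le′ (inj₁ e) = inject₁≢suc i (IsLinExt.distinct le L R e)
  swap-isLinExt⇒incomparable le le′ (inj₂ (inj₁ pL<pR)) =
    R≮L (IsLinExt.ordered le′ R L (subst₂ _<P_ (sym (swap-adjacent-right p i)) (sym (swap-adjacent-left p i)) pL<pR))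
  swap-isLinExt⇒incomparable le le′ (inj₂ (inj₂ pR<pL)) = R≮L (IsLinExt.ordered le R L pR<pL)

module _ {n : ℕ} {_<P_ : Fin n → Fin n → Set} where

  -- strong induction on positions: at the first disagreement one entry would have to occur earlier
  linExt-unique : ∀ {p q} → IsLinExt _<P_ p → IsLinExt _<P_ q →
                  (∀ j → Comparable _<P_ (lookup p j) (lookup q j)) → p ≡ q
  linExt-unique {p} {q} lp lq comparable = vec-ext (λ j → agreeBelow (suc (toℕ j)) j ≤-refl)
    where
    module P = IsLinExt lp
    module Q = IsLinExt lq
    agreeAt : ∀ j → (∀ i → i Fin.< j → lookup p i ≡ lookup q i) → lookup p j ≡ lookup q j
    agreeAt j ih with comparable j
    ... | inj₁ e = e
    ... | inj₂ (inj₁ pj<qj) with i , qi≡pj ← position (Q.covers (lookup p j)) =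
      ⊥-elim (<⇒≢ i<j (cong toℕ (P.distinct i j (trans (ih i i<j) qi≡pj))))
      where
      i<j : i Fin.< j
      i<j = Q.ordered i j (subst (_<P _) (sym qi≡pj) pj<qj)
    ... | inj₂ (inj₂ qj<pj) with i , pi≡qj ← position (P.covers (lookup q j)) =
      ⊥-elim (<⇒≢ i<j (cong toℕ (Q.distinct i j (trans (sym (ih i i<j)) pi≡qj))))
      where
      i<j : i Fin.< j
      i<j = P.ordered i j (subst (_<P _) (sym pi≡qj) qj<pj)
    agreeBelow : ∀ m j → toℕ j < m → lookup p j ≡ lookup q j
    agreeBelow (suc m) j j<m = agreeAt j (λ i i<j → agreeBelow m i (≤-trans i<j (≤-pred j<m)))

module BenderKnuth {k : ℕ} {_<P_ : Fin (suc k) → Fin (suc k) → Set}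
                   (comparable? : ∀ x y → Dec (Comparable _<P_ x y)) where

  bkMove : Fin k → Vec (Fin (suc k)) (suc k) → Vec (Fin (suc k)) (suc k)
  bkMove i p with comparable? (lookup p (inject₁ i)) (lookup p (Fin.suc i))
  ... | yes _ = p
  ... | no _  = swap p (inject₁ i) (Fin.suc i)

  bkMove-BK : ∀ i p → BK _<P_ i p (bkMove i p)
  bkMove-BK i p with comparable? (lookup p (inject₁ i)) (lookup p (Fin.suc i))
  ... | yes c = bk-fix c
  ... | no ¬c = bk-swap ¬c

  bkAct : List (Fin k) → Vec (Fin (suc k)) (suc k) → Vec (Fin (suc k)) (suc k)
  bkAct ws p = foldr bkMove p ws

  bkAct-BKWord : ∀ ws p → BKWord _<P_ ws p (bkAct ws p)
  bkAct-BKWord []       p = w-nil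
  bkAct-BKWord (i ∷ ws) p = w-cons (bkAct-BKWord ws p) (bkMove-BK i (bkAct ws p))

  bkMove-swapped : ∀ i {p} → IsLinExt _<P_ p → IsLinExt _<P_ (swap p (inject₁ i) (Fin.suc i)) →
                   bkMove i p ≡ swap p (inject₁ i) (Fin.suc i)
  bkMove-swapped i {p} le le′ with comparable? (lookup p (inject₁ i)) (lookup p (Fin.suc i))
  ... | yes c = ⊥-elim (swap-isLinExt⇒incomparable i le le′ c)
  ... | no _  = refl

  bkMove-fixed : ∀ i {p} → IsLinExt _<P_ p → ¬ IsLinExt _<P_ (swap p (inject₁ i) (Fin.suc i)) →
                 bkMove i p ≡ p
  bkMove-fixed i {p} le ¬le′ with comparable? (lookup p (inject₁ i)) (lookup p (Fin.suc i))
  ... | yes _ = refl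
  ... | no ¬c = ⊥-elim (¬le′ (swap-isLinExt i le ¬c))

-- The poset N_{1,b,1}

Elt : ℕ → Set
Elt b = Fin (suc (suc (b + 1)))

toℕ≤ : ∀ b (x : Elt b) → toℕ x ≤ suc (suc b)
toℕ≤ b x = subst (λ m → toℕ x ≤ suc m) (+-comm b 1) (≤-pred (toℕ<n x))

elt : ∀ b n → n ≤ suc (suc b) → Elt b
elt b n n≤ = fromℕ< (s≤s (subst (λ m → n ≤ suc m) (+-comm 1 b) n≤))

toℕ-elt : ∀ b n (n≤ : n ≤ suc (suc b)) → toℕ (elt b n n≤) ≡ n
toℕ-elt b n n≤ = toℕ-fromℕ< _

-- The order of N_{1,b,1} on the underlying numbers: the chain b+1 < b < ⋯ < 1,
-- together with 0 < 1 and b+1 < b+2.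
Below : ℕ → ℕ → ℕ → Set
Below b u v = (u ≡ 0 × v ≡ 1) ⊎ (u ≡ suc b × v ≡ suc (suc b)) ⊎ (1 ≤ v × v < u × u ≤ suc b)

below? : ∀ b u v → Dec (Below b u v)
below? b u v = ((u ≟ 0) ×-dec (v ≟ 1)) ⊎-dec (((u ≟ suc b) ×-dec (v ≟ suc (suc b)))
               ⊎-dec ((1 ≤? v) ×-dec ((suc v ≤? u) ×-dec (u ≤? suc b))))

Below-trans : ∀ b {u v w} → 1 ≤ b → Below b u v → Below b v w → Below b u w
Below-trans b b≥1 (inj₁ (refl , refl)) (inj₁ (() , _))
Below-trans b b≥1 (inj₁ (refl , refl)) (inj₂ (inj₁ (1≡sb , _))) = ⊥-elim (<⇒≱ (s≤s b≥1) (≤-reflexive (sym 1≡sb)))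
Below-trans b b≥1 (inj₁ (refl , refl)) (inj₂ (inj₂ (w≥1 , w<1 , _))) = ⊥-elim (<⇒≱ w<1 w≥1)
Below-trans b b≥1 (inj₂ (inj₁ (refl , refl))) (inj₁ (() , _))
Below-trans b b≥1 (inj₂ (inj₁ (refl , refl))) (inj₂ (inj₁ (e , _))) = ⊥-elim (1+n≢n e)
Below-trans b b≥1 (inj₂ (inj₁ (refl , refl))) (inj₂ (inj₂ (_ , _ , ssb≤sb))) = ⊥-elim (1+n≰n ssb≤sb)
Below-trans b b≥1 (inj₂ (inj₂ (v≥1 , _ , _))) (inj₁ (refl , _)) = ⊥-elim (<⇒≱ v≥1 z≤n)
Below-trans b b≥1 (inj₂ (inj₂ (_ , v<u , u≤sb))) (inj₂ (inj₁ (refl , _))) = ⊥-elim (<⇒≱ v<u u≤sb)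
Below-trans b b≥1 (inj₂ (inj₂ (_ , v<u , u≤sb))) (inj₂ (inj₂ (w≥1 , w<v , _))) =
  inj₂ (inj₂ (w≥1 , <-trans w<v v<u , u≤sb))

cover⇒Below : ∀ b (x y : Elt b) → NCover 1 b 1 x y → Below b (toℕ x) (toℕ y)
cover⇒Below b x y (inj₁ (e , inj₁ y≤1)) with toℕ x | toℕ y
cover⇒Below b x y (inj₁ (refl , inj₁ (s≤s z≤n))) | zero | .1 = inj₁ (refl , refl)
cover⇒Below b x y (inj₁ (e , inj₂ sb<y)) = inj₂ (inj₁ (suc-injective (trans e y≡ssb) , y≡ssb))
  where
  y≡ssb : toℕ y ≡ suc (suc b)
  y≡ssb = ≤-antisym (toℕ≤ b y) sb<y
cover⇒Below b x y (inj₂ (x≡sy , 1<x , x≤sb)) =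
  inj₂ (inj₂ (≤-pred (subst (1 <_) x≡sy 1<x) , ≤-reflexive (sym x≡sy) , x≤sb))

N<⇒Below : ∀ b → 1 ≤ b → (x y : Elt b) → N< 1 b 1 x y → Below b (toℕ x) (toℕ y)
N<⇒Below b b≥1 x y [ c ]           = cover⇒Below b x y c
N<⇒Below b b≥1 x y (_∷_ {y = z} c r) = Below-trans b b≥1 (cover⇒Below b x z c) (N<⇒Below b b≥1 z y r)

chain-N< : ∀ b d (u v : Elt b) → toℕ u ≡ suc d + toℕ v → 1 ≤ toℕ v → toℕ u ≤ suc b → N< 1 b 1 u v
chain-N< b zero    u v e v≥1 u≤sb = [ inj₂ (e , ≤-trans (s≤s v≥1) (≤-reflexive (sym e)) , u≤sb) ]
chain-N< b (suc d) u v e v≥1 u≤sb =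
  inj₂ (u≡sw , ≤-trans (s≤s (s≤s z≤n)) (≤-reflexive (sym e)) , u≤sb) ∷ chain-N< b d w v (toℕ-elt b _ w≤) v≥1 w≤sb
  where
  w≤sb′ : suc d + toℕ v ≤ suc b
  w≤sb′ = ≤-trans (n≤1+n _) (subst (_≤ suc b) e u≤sb)
  w≤ : suc d + toℕ v ≤ suc (suc b)
  w≤ = ≤-trans w≤sb′ (n≤1+n _)
  w = elt b (suc d + toℕ v) w≤
  w≤sb : toℕ w ≤ suc b
  w≤sb = subst (_≤ suc b) (sym (toℕ-elt b _ w≤)) w≤sb′
  u≡sw : toℕ u ≡ suc (toℕ w)
  u≡sw = trans e (cong suc (sym (toℕ-elt b _ w≤)))

Below⇒N< : ∀ b (x y : Elt b) → Below b (toℕ x) (toℕ y) → N< 1 b 1 x y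
Below⇒N< b x y (inj₁ (x≡0 , y≡1)) = [ inj₁ (trans (cong suc x≡0) (sym y≡1) , inj₁ (≤-reflexive y≡1)) ]
Below⇒N< b x y (inj₂ (inj₁ (x≡sb , y≡ssb))) =
  [ inj₁ (trans (cong suc x≡sb) (sym y≡ssb) , inj₂ (≤-reflexive (sym y≡ssb))) ]
Below⇒N< b x y (inj₂ (inj₂ (y≥1 , y<x , x≤sb))) = chain-N< b (toℕ x ∸ suc (toℕ y)) x y x≡ y≥1 x≤sb
  where
  x≡ : toℕ x ≡ suc (toℕ x ∸ suc (toℕ y)) + toℕ y
  x≡ = sym (trans (cong (_+ toℕ y) (sym (+-∸-assoc 1 y<x))) (m∸n+n≡m (≤-trans (n≤1+n _) y<x)))

comparable? : ∀ b → 1 ≤ b → (x y : Elt b) → Dec (Comparable (N< 1 b 1) x y)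
comparable? b b≥1 x y with x Fin.≟ y | below? b (toℕ x) (toℕ y) | below? b (toℕ y) (toℕ x)
... | yes x≡y | _ | _ = yes (inj₁ x≡y)
... | no _ | yes x<y | _ = yes (inj₂ (inj₁ (Below⇒N< b x y x<y)))
... | no _ | no _ | yes y<x = yes (inj₂ (inj₂ (Below⇒N< b y x y<x)))
... | no x≢y | no x≮y | no y≮x = no λ
  { (inj₁ x≡y)        → x≢y x≡y
  ; (inj₂ (inj₁ x<y)) → x≮y (N<⇒Below b b≥1 x y x<y)
  ; (inj₂ (inj₂ y<x)) → y≮x (N<⇒Below b b≥1 y x y<x) }

-- States and moves

-- A data type rather than ℕ × ℕ: with η for pairs, move would unfold on neutral
-- states, and comparing such terms during type checking grows exponentially.
data State : Set where
  ⟨_,_⟩ : ℕ → ℕ → State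

_≟ₛ_ : DecidableEquality State
⟨ x , y ⟩ ≟ₛ ⟨ x' , y' ⟩ with x ≟ x' | y ≟ y'
... | yes refl | yes refl = yes refl
... | no x≢x'  | _        = no λ { refl → x≢x' refl }
... | yes _    | no y≢y'  = no λ { refl → y≢y' refl }

state-cong : ∀ {x y x' y'} → x ≡ x' → y ≡ y' → ⟨ x , y ⟩ ≡ ⟨ x' , y' ⟩
state-cong refl refl = refl

-- x and y are the positions of 0 and b+2; the conditions say that 0 precedes
-- element 1 (the last chain entry) and b+2 follows element b+1 (the first).
record IsState (b x y : ℕ) : Set where
  field
    x≤ : x ≤ suc b
    y≥ : 1 ≤ y
    y≤ : y ≤ suc (suc b)
    x≢y : x ≢ y
    ¬last : ¬ (x ≡ suc b × y ≡ suc (suc b))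
    ¬first : ¬ (x ≡ 0 × y ≡ 1)

isState? : ∀ b x y → Dec (IsState b x y)
isState? b x y =
  map′ (λ (a , c , d , e , f , g) → record { x≤ = a ; y≥ = c ; y≤ = d ; x≢y = e ; ¬last = f ; ¬first = g })
       (λ r → let open IsState r in x≤ , y≥ , y≤ , x≢y , ¬last , ¬first)
       ((x ≤? suc b) ×-dec (1 ≤? y) ×-dec (y ≤? suc (suc b)) ×-dec ¬? (x ≟ y) ×-dec
        ¬? ((x ≟ suc b) ×-dec (y ≟ suc (suc b))) ×-dec ¬? ((x ≟ 0) ×-dec (y ≟ 1)))

validᵇ : ℕ → State → Bool
validᵇ b ⟨ x , y ⟩ = isYes (isState? b x y)

-- A record, so that Valid b s determines s during unification.
record Valid (b : ℕ) (s : State) : Set where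
  constructor valid
  field isValid : T (validᵇ b s)

valid⇒IsState : ∀ b {x y} → Valid b ⟨ x , y ⟩ → IsState b x y
valid⇒IsState b {x} {y} (valid v) = toWitness {a? = isState? b x y} v

IsState⇒valid : ∀ b {x y} → IsState b x y → Valid b ⟨ x , y ⟩
IsState⇒valid b {x} {y} st = valid (fromWitness {a? = isState? b x y} st)

valid? : ∀ b s → Dec (Valid b s)
valid? b s = map′ valid Valid.isValid (T? (validᵇ b s))

valid-irrelevant : ∀ b {s} (v v' : Valid b s) → v ≡ v'
valid-irrelevant b (valid v) (valid v') = cong valid (T-irrelevant v v')

Bounded : ℕ → State → Set
Bounded b ⟨ x , y ⟩ = x ≤ suc (suc b) × y ≤ suc (suc b)

valid⇒bounded : ∀ b {s} → Valid b s → Bounded b s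
valid⇒bounded b {⟨ x , y ⟩} v = let open IsState (valid⇒IsState b v) in ≤-trans x≤ (n≤1+n _) , y≤

move : ℕ → ℕ → State → State
move b i ⟨ x , y ⟩ with isState? b (τ i x) (τ i y)
... | yes _ = ⟨ τ i x , τ i y ⟩
... | no _  = ⟨ x , y ⟩

move-moves : ∀ b i {x y} → IsState b (τ i x) (τ i y) → move b i ⟨ x , y ⟩ ≡ ⟨ τ i x , τ i y ⟩
move-moves b i {x} {y} st with isState? b (τ i x) (τ i y)
... | yes _  = refl
... | no ¬st = ⊥-elim (¬st st)

move-to : ∀ b i {x y x' y'} → τ i x ≡ x' → τ i y ≡ y' → IsState b x' y' → move b i ⟨ x , y ⟩ ≡ ⟨ x' , y' ⟩
move-to b i refl refl st = move-moves b i st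

move-stays : ∀ b i {x y} → ¬ IsState b (τ i x) (τ i y) → move b i ⟨ x , y ⟩ ≡ ⟨ x , y ⟩
move-stays b i {x} {y} ¬st with isState? b (τ i x) (τ i y)
... | yes st = ⊥-elim (¬st st)
... | no _   = refl

move-valid : ∀ b i {s} → Valid b s → Valid b (move b i s)
move-valid b i {⟨ x , y ⟩} v with isState? b (τ i x) (τ i y)
... | yes st = IsState⇒valid b st
... | no _   = v

move-involutive : ∀ b i {s} → Valid b s → move b i (move b i s) ≡ s
move-involutive b i {⟨ x , y ⟩} v with isState? b (τ i x) (τ i y)
... | yes _ = trans (move-moves b i (subst₂ (IsState b) (sym ττx) (sym ττy) (valid⇒IsState b v))) (state-cong ττx ττy)
  where
  ττx = τ-involutive i x
  ττy = τ-involutive i y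
... | no ¬st = move-stays b i ¬st

move-out-of-range : ∀ b i {s} → suc b < i → Valid b s → move b i s ≡ s
move-out-of-range b i {⟨ x , y ⟩} sb<i v with valid⇒IsState b v
... | st with τ-view i y
...   | left         = move-stays b i (λ st′ → <⇒≱ sb<i (≤-pred (subst (_≤ suc (suc b)) (τ-left i) (IsState.y≤ st′))))
...   | right        = ⊥-elim (<⇒≱ sb<i (≤-pred (IsState.y≤ st)))
...   | other y≢i y≢si = trans (move-moves b i (subst₂ (IsState b) (sym τx≡x) (sym τy≡y) st)) (state-cong τx≡x τy≡y)
  where
  x≤sb = IsState.x≤ st
  τx≡x : τ i x ≡ x
  τx≡x = τ-other (λ e → <⇒≱ sb<i (subst (_≤ suc b) e x≤sb))
                 (λ e → <⇒≱ sb<i (≤-trans (n≤1+n _) (subst (_≤ suc b) e x≤sb)))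
  τy≡y : τ i y ≡ y
  τy≡y = τ-other y≢i y≢si

module Moves (b : ℕ) = InvolutionWords _≟ₛ_ (Valid b) (move b) (move-valid b) (move-involutive b)
open Moves

-- Every transposition of states is realized

-- Reversing a linear extension and relabelling v ↦ b+2−v is an anti-automorphism of N_{1,b,1}.
mirror : ℕ → State → State
mirror b ⟨ x , y ⟩ = ⟨ suc (suc b) ∸ y , suc (suc b) ∸ x ⟩

mirrorIndex : ℕ → ℕ → ℕ
mirrorIndex b i with i ≤? suc b
... | yes _ = suc b ∸ i
... | no _  = i

private
  sb∸i : ∀ {b i} → i ≤ suc b → suc (suc b) ∸ i ≡ suc (suc b ∸ i)
  sb∸i i≤ = +-∸-assoc 1 i≤

τ-bounded : ∀ b {i p} → i ≤ suc b → p ≤ suc (suc b) → τ i p ≤ suc (suc b)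
τ-bounded b {i} {p} i≤ p≤ with τ-view i p
... | left  = subst (_≤ suc (suc b)) (sym (τ-left i)) (s≤s i≤)
... | right = subst (_≤ suc (suc b)) (sym (τ-right i)) (≤-trans i≤ (n≤1+n _))
... | other p≢i p≢si = subst (_≤ suc (suc b)) (sym (τ-other p≢i p≢si)) p≤

τ-mirror : ∀ b {i p} → i ≤ suc b → p ≤ suc (suc b) →
           τ (suc b ∸ i) (suc (suc b) ∸ p) ≡ suc (suc b) ∸ τ i p
τ-mirror b {i} {p} i≤ p≤ with τ-view i p
... | left  rewrite τ-left p | sb∸i {b} i≤ = τ-right (suc b ∸ p)
... | right rewrite τ-right i | sb∸i {b} i≤ = τ-left (suc b ∸ i)
... | other p≢i p≢si rewrite τ-other p≢i p≢si = τ-other m≢ m≢s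
  where
  m≢ : suc (suc b) ∸ p ≢ suc b ∸ i
  m≢ e = p≢si (∸-cancelˡ-≡ p≤ (s≤s i≤) e)
  m≢s : suc (suc b) ∸ p ≢ suc (suc b ∸ i)
  m≢s e = p≢i (∸-cancelˡ-≡ p≤ (≤-trans i≤ (n≤1+n _)) (trans e (sym (sb∸i {b} i≤))))

IsState-mirror : ∀ {b x y} → x ≤ suc (suc b) → IsState b x y → IsState b (suc (suc b) ∸ y) (suc (suc b) ∸ x)
IsState-mirror {b} {x} {y} x≤ssb st = record
  { x≤ = ∸-monoʳ-≤ (suc (suc b)) y≥
  ; y≥ = ≤-trans (s≤s z≤n) (≤-reflexive (sym (sb∸i {b} x≤)))
  ; y≤ = m∸n≤m _ x
  ; x≢y = λ e → x≢y (sym (∸-cancelˡ-≡ y≤ x≤ssb e))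
  ; ¬last = λ (e₁ , e₂) → ¬first (∸-cancelˡ-≡ x≤ssb z≤n e₂ , ∸-cancelˡ-≡ y≤ (s≤s z≤n) e₁)
  ; ¬first = λ (e₁ , e₂) → ¬last (∸-cancelˡ-≡ x≤ssb (n≤1+n _) (trans e₂ (sym ssb∸sb≡1)) ,
                                  ∸-cancelˡ-≡ y≤ ≤-refl (trans e₁ (sym (n∸n≡0 (suc (suc b))))))
  }
  where
  open IsState st
  ssb∸sb≡1 : suc (suc b) ∸ suc b ≡ 1
  ssb∸sb≡1 = trans (sb∸i {b} ≤-refl) (cong suc (n∸n≡0 b))

IsState-unmirror : ∀ {b x y} → x ≤ suc (suc b) → y ≤ suc (suc b) →
                   IsState b (suc (suc b) ∸ y) (suc (suc b) ∸ x) → IsState b x y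
IsState-unmirror {b} {x} {y} x≤ y≤ st =
  subst₂ (IsState b) (m∸[m∸n]≡n x≤) (m∸[m∸n]≡n y≤) (IsState-mirror (m∸n≤m (suc (suc b)) y) st)

mirror-valid : ∀ b {s} → Valid b s → Valid b (mirror b s)
mirror-valid b {⟨ x , y ⟩} v = IsState⇒valid b (IsState-mirror (≤-trans (IsState.x≤ st) (n≤1+n _)) st)
  where st = valid⇒IsState b v

mirror-involutive : ∀ b {s} → Bounded b s → mirror b (mirror b s) ≡ s
mirror-involutive b {⟨ x , y ⟩} (x≤ , y≤) = state-cong (m∸[m∸n]≡n x≤) (m∸[m∸n]≡n y≤)

move-mirror : ∀ b i {s} → i ≤ suc b → Bounded b s → move b (suc b ∸ i) (mirror b s) ≡ mirror b (move b i s)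
move-mirror b i {⟨ x , y ⟩} i≤ (x≤ , y≤) with isState? b (τ i x) (τ i y)
... | yes st = trans (move-moves b (suc b ∸ i) (subst₂ (IsState b) (sym τ′y) (sym τ′x) st′)) (state-cong τ′y τ′x)
  where
  τ′x = τ-mirror b i≤ x≤
  τ′y = τ-mirror b i≤ y≤
  st′ = IsState-mirror (τ-bounded b i≤ x≤) st
... | no ¬st = move-stays b (suc b ∸ i) λ st′ →
  ¬st (IsState-unmirror (τ-bounded b i≤ x≤) (τ-bounded b i≤ y≤)
         (subst₂ (IsState b) (τ-mirror b i≤ y≤) (τ-mirror b i≤ x≤) st′))

move-mirrorIndex : ∀ b i {s} → Valid b s → move b (mirrorIndex b i) (mirror b s) ≡ mirror b (move b i s)
move-mirrorIndex b i v with i ≤? suc b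
... | yes i≤ = move-mirror b i i≤ (valid⇒bounded b v)
... | no i≰  = trans (move-out-of-range b i (≰⇒> i≰) (mirror-valid b v))
                     (cong (mirror b) (sym (move-out-of-range b i (≰⇒> i≰) v)))

act-mirror : ∀ b w {s} → Valid b s → act b (map (mirrorIndex b) w) (mirror b s) ≡ mirror b (act b w s)
act-mirror b []      v = refl
act-mirror b (i ∷ w) v =
  trans (cong (move b (mirrorIndex b i)) (act-mirror b w v)) (move-mirrorIndex b i (act-valid b w v))

transposable-mirror : ∀ b {a c} → Valid b a → Valid b c → Transposable b a c →
                      Transposable b (mirror b a) (mirror b c)
transposable-mirror b = transposable-conjugate b (mirror b) (map (mirrorIndex b)) (mirror-valid b)
  (λ v → mirror-involutive b (valid⇒bounded b v)) (act-mirror b)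

states : ℕ → List State
states b = cartesianProductWith ⟨_,_⟩ (upTo (3 + b)) (upTo (3 + b))

states-complete : ∀ b {s} → Valid b s → s ∈ₗ states b
states-complete b {⟨ x , y ⟩} v with x≤ , y≤ ← valid⇒bounded b v =
  ∈-cartesianProductWith⁺ ⟨_,_⟩ (∈-upTo⁺ (s≤s x≤)) (∈-upTo⁺ (s≤s y≤))

RealizesAt : ℕ → List ℕ → (State → State) → State → Set
RealizesAt b w f s = Valid b s → act b w s ≡ f s

realizesAt? : ∀ b w f s → Dec (RealizesAt b w f s)
realizesAt? b w f s = valid? b s →-dec (act b w s ≟ₛ f s)

transposable-by-computation : ∀ b w {a c} →
  True (all? (realizesAt? b w (exchange b a c)) (states b)) → Transposable b a c
transposable-by-computation b w {a} {c} h =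
  w , λ s v → All.lookup (toWitness {a? = all? (realizesAt? b w (exchange b a c)) (states b)} h) (states-complete b v) v

p₀ p₁ q₀ : State
p₀ = ⟨ 0 , 2 ⟩
p₁ = ⟨ 1 , 2 ⟩
q₀ = ⟨ 0 , 3 ⟩

-- (τ₁τ₂)³ = 1, so this word fixes every state on which all six moves go through;
-- the only blocked orbit is {p₀, q₀} (its third point ⟨ 0 , 1 ⟩ is not a state).
W₃ : List ℕ
W₃ = 1 ∷ 2 ∷ 1 ∷ 2 ∷ 1 ∷ 2 ∷ []

W₀ : List ℕ
W₀ = 0 ∷ 1 ∷ 0 ∷ 1 ∷ 0 ∷ 1 ∷ []

τs : List ℕ → ℕ → ℕ
τs w p = foldr τ p w

MovesFreely : ℕ → List ℕ → State → Set
MovesFreely b []      _       = ⊤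
MovesFreely b (i ∷ w) ⟨ x , y ⟩ = IsState b (τ i (τs w x)) (τ i (τs w y)) × MovesFreely b w ⟨ x , y ⟩

act-freely : ∀ b w x y → MovesFreely b w ⟨ x , y ⟩ → act b w ⟨ x , y ⟩ ≡ ⟨ τs w x , τs w y ⟩
act-freely b []      x y _           = refl
act-freely b (i ∷ w) x y (st , free) = trans (cong (move b i) (act-freely b w x y free)) (move-moves b i st)

τ₁τ₂-cubed : ∀ p → τs W₃ p ≡ p
τ₁τ₂-cubed 0 = refl
τ₁τ₂-cubed 1 = refl
τ₁τ₂-cubed 2 = refl
τ₁τ₂-cubed 3 = refl
τ₁τ₂-cubed (suc (suc (suc (suc _)))) = refl

W₃-fixes : ∀ b x y → MovesFreely b W₃ ⟨ x , y ⟩ → act b W₃ ⟨ x , y ⟩ ≡ ⟨ x , y ⟩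
W₃-fixes b x y free = trans (act-freely b W₃ x y free) (state-cong (τ₁τ₂-cubed x) (τ₁τ₂-cubed y))

IsState-first : ∀ {b y} → 2 ≤ y → y ≤ suc (suc b) → IsState b 0 y
IsState-first y≥2 y≤ = record
  { x≤ = z≤n ; y≥ = ≤-trans (s≤s z≤n) y≥2 ; y≤ = y≤
  ; x≢y = λ e → n≮0 (subst (2 ≤_) (sym e) y≥2)
  ; ¬last = λ { (() , _) } ; ¬first = λ (_ , e) → n≮n 1 (subst (2 ≤_) e y≥2) }

move-first : ∀ b j → 3 + j ≤ suc (suc b) → move b (2 + j) ⟨ 0 , 2 + j ⟩ ≡ ⟨ 0 , 3 + j ⟩
move-first b j le = trans (move-moves b (2 + j) (subst (IsState b 0) (sym τ≡) (IsState-first (s≤s (s≤s z≤n)) le)))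
                          (cong ⟨ 0 ,_⟩ τ≡)
  where τ≡ = τ-left (2 + j)

module AtLeastThree (m : ℕ) where

  b = 3 + m

  4+k≢small : ∀ {k j} → j ≤ 3 → 4 + k ≢ j
  4+k≢small j≤3 refl = 1+n≰n (≤-trans (s≤s (s≤s (s≤s (s≤s z≤n)))) j≤3)

  farLeft : ∀ {k j} {j≥1 : True (1 ≤? j)} {j≤3 : True (j ≤? 3)} → 4 + k ≤ suc b → IsState b (4 + k) j
  farLeft {j≥1 = j≥1} {j≤3} x≤ = record
    { x≤ = x≤ ; y≥ = toWitness j≥1 ; y≤ = ≤-trans (toWitness j≤3) (s≤s (s≤s (s≤s z≤n)))
    ; x≢y = 4+k≢small (toWitness j≤3)
    ; ¬last = λ (_ , e) → 4+k≢small {k = suc m} (toWitness j≤3) (sym e)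
    ; ¬first = λ { (() , _) } }

  farRight : ∀ {k j} {j≤3 : True (j ≤? 3)} → 4 + k ≤ suc (suc b) → IsState b j (4 + k)
  farRight {j≤3 = j≤3} y≤ = record
    { x≤ = ≤-trans (toWitness j≤3) (s≤s (s≤s (s≤s z≤n))) ; y≥ = s≤s z≤n ; y≤ = y≤
    ; x≢y = λ e → 4+k≢small (toWitness j≤3) (sym e)
    ; ¬last = λ (e , _) → 4+k≢small {k = m} (toWitness j≤3) (sym e)
    ; ¬first = λ { (_ , ()) } }

  W₃-realizes : ∀ s → Valid b s → act b W₃ s ≡ exchange b p₀ q₀ s
  W₃-realizes ⟨ 0 , 0 ⟩ (valid ())
  W₃-realizes ⟨ 0 , 1 ⟩ (valid ())
  W₃-realizes ⟨ 0 , 2 ⟩ _ = refl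
  W₃-realizes ⟨ 0 , 3 ⟩ _ = refl
  W₃-realizes ⟨ 1 , 0 ⟩ (valid ())
  W₃-realizes ⟨ 1 , 1 ⟩ (valid ())
  W₃-realizes ⟨ 1 , 2 ⟩ _ = refl
  W₃-realizes ⟨ 1 , 3 ⟩ _ = refl
  W₃-realizes ⟨ 2 , 0 ⟩ (valid ())
  W₃-realizes ⟨ 2 , 1 ⟩ _ = refl
  W₃-realizes ⟨ 2 , 2 ⟩ (valid ())
  W₃-realizes ⟨ 2 , 3 ⟩ _ = refl
  W₃-realizes ⟨ 3 , 0 ⟩ (valid ())
  W₃-realizes ⟨ 3 , 1 ⟩ _ = refl
  W₃-realizes ⟨ 3 , 2 ⟩ _ = refl
  W₃-realizes ⟨ 3 , 3 ⟩ (valid ())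
  W₃-realizes ⟨ suc (suc (suc (suc _))) , 0 ⟩ v = ⊥-elim (<⇒≱ (s≤s z≤n) (IsState.y≥ (valid⇒IsState b v)))
  W₃-realizes ⟨ x@(suc (suc (suc (suc _)))) , y@(suc (suc (suc (suc _)))) ⟩ v = W₃-fixes b x y (st , st , st , st , st , st , _)
    where st = valid⇒IsState b v
  W₃-realizes ⟨ x@(suc (suc (suc (suc _)))) , 1 ⟩ v = W₃-fixes b x 1 (st , st , st , st , st , st , _)
    where st = λ {j} {j≥1} {j≤3} → farLeft {j = j} {j≥1} {j≤3} (IsState.x≤ (valid⇒IsState b v))
  W₃-realizes ⟨ x@(suc (suc (suc (suc _)))) , 2 ⟩ v = W₃-fixes b x 2 (st , st , st , st , st , st , _)
    where st = λ {j} {j≥1} {j≤3} → farLeft {j = j} {j≥1} {j≤3} (IsState.x≤ (valid⇒IsState b v))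
  W₃-realizes ⟨ x@(suc (suc (suc (suc _)))) , 3 ⟩ v = W₃-fixes b x 3 (st , st , st , st , st , st , _)
    where st = λ {j} {j≥1} {j≤3} → farLeft {j = j} {j≥1} {j≤3} (IsState.x≤ (valid⇒IsState b v))
  W₃-realizes ⟨ 0 , y@(suc (suc (suc (suc _)))) ⟩ v = W₃-fixes b 0 y (st , st , st , st , st , st , _)
    where st = valid⇒IsState b v
  W₃-realizes ⟨ 1 , y@(suc (suc (suc (suc _)))) ⟩ v = W₃-fixes b 1 y (st , st , st , st , st , st , _)
    where st = λ {j} {j≤3} → farRight {j = j} {j≤3} (IsState.y≤ (valid⇒IsState b v))
  W₃-realizes ⟨ 2 , y@(suc (suc (suc (suc _)))) ⟩ v = W₃-fixes b 2 y (st , st , st , st , st , st , _)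
    where st = λ {j} {j≤3} → farRight {j = j} {j≤3} (IsState.y≤ (valid⇒IsState b v))
  W₃-realizes ⟨ 3 , y@(suc (suc (suc (suc _)))) ⟩ v = W₃-fixes b 3 y (st , st , st , st , st , st , _)
    where st = λ {j} {j≤3} → farRight {j = j} {j≤3} (IsState.y≤ (valid⇒IsState b v))

  p₀⇄top-at : ∀ j → 3 + j ≤ suc (suc b) → Transposable b p₀ ⟨ 0 , 3 + j ⟩
  p₀⇄top-at zero    _  = W₃ , W₃-realizes
  p₀⇄top-at (suc j) le = subst (Transposable b p₀) (move-first b (suc j) le)
    (transposable-conjugate-t b (3 + j) _ (IsState⇒valid b (IsState-first (s≤s (s≤s z≤n)) le′)) (p₀⇄top-at j le′))
    where le′ = ≤-trans (n≤1+n _) le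

  r₀ r₁ : State
  r₀ = ⟨ 0 , 5 + m ⟩
  r₁ = ⟨ 1 , 5 + m ⟩

  p₀⇄r₀ : Transposable b p₀ r₀
  p₀⇄r₀ = p₀⇄top-at (2 + m) ≤-refl

  private
    v₄ = IsState⇒valid b (IsState-first {b} (s≤s (s≤s z≤n)) (n≤1+n _))
    v₅ = IsState⇒valid b (IsState-first {b} (s≤s (s≤s z≤n)) ≤-refl)
    st₁₅ : IsState b 1 (5 + m)
    st₁₅ = record { x≤ = s≤s z≤n ; y≥ = s≤s z≤n ; y≤ = ≤-refl ; x≢y = λ ()
                  ; ¬last = λ { (() , _) } ; ¬first = λ { (() , _) } }
    v₁₅ = IsState⇒valid b st₁₅

  -- mirror sends ⟨ 0 , b+1 ⟩ to r₁ and fixes r₀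
  r₁⇄r₀ : Transposable b r₁ r₀
  r₁⇄r₀ = subst₂ (Transposable b) (cong ⟨_, 5 + m ⟩ (m+n∸n≡m 1 (4 + m))) (cong ⟨_, 5 + m ⟩ (n∸n≡0 (5 + m)))
    (transposable-mirror b v₄ v₅
      (transposable-trans b v₄ _ v₅ (transposable-sym b (p₀⇄top-at (1 + m) (n≤1+n _))) p₀⇄r₀))

  p₁⇄r₁ : Transposable b p₁ r₁
  p₁⇄r₁ = subst (Transposable b p₁) (move-moves b 0 st₁₅) (transposable-conjugate-t b 0 _ v₅ p₀⇄r₀)

  p₁⇄p₀ : Transposable b p₁ p₀
  p₁⇄p₀ = transposable-trans b _ v₁₅ _ p₁⇄r₁ (transposable-trans b v₁₅ v₅ _ r₁⇄r₀ (transposable-sym b p₀⇄r₀))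

-- For b = 1, 2 the words conjugate (τ₁τ₂)³ resp. (τ₀τ₁)³ and are checked by evaluation.
p₁⇄p₀ : ∀ b → 1 ≤ b → Transposable b p₁ p₀
p₁⇄p₀ 1 _ = transposable-by-computation 1 (u ++ W₃ ++ reverse u) _
  where u = 1 ∷ 2 ∷ 0 ∷ 1 ∷ 0 ∷ []
p₁⇄p₀ 2 _ = transposable-by-computation 2 (u ++ W₀ ++ reverse u) _
  where u = 1 ∷ 2 ∷ 3 ∷ 1 ∷ 0 ∷ 1 ∷ 2 ∷ 3 ∷ 2 ∷ []
p₁⇄p₀ (suc (suc (suc m))) _ = AtLeastThree.p₁⇄p₀ m

q₀⇄p₀ : ∀ b → 1 ≤ b → Transposable b q₀ p₀
q₀⇄p₀ 1 _ = transposable-by-computation 1 W₃ _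
q₀⇄p₀ 2 _ = transposable-by-computation 2 (u ++ W₀ ++ reverse u) _
  where u = 0 ∷ 1 ∷ 2 ∷ []
q₀⇄p₀ (suc (suc (suc m))) _ = transposable-sym _ (AtLeastThree.p₀⇄top-at m 0 (s≤s (s≤s (s≤s z≤n))))

transposable-move-p₀ : ∀ b → 1 ≤ b → ∀ i → Transposable b (move b i p₀) p₀
transposable-move-p₀ b b≥1 0 = subst (λ s → Transposable b s p₀) (sym (move-moves b 0 st₁₂)) (p₁⇄p₀ b b≥1)
  where
  st₁₂ : IsState b 1 2
  st₁₂ = record { x≤ = s≤s z≤n ; y≥ = s≤s z≤n ; y≤ = s≤s (s≤s z≤n) ; x≢y = λ ()
                ; ¬last = λ (e , _) → <⇒≢ b≥1 (suc-injective e) ; ¬first = λ { (() , _) } }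
transposable-move-p₀ b b≥1 1 =
  subst (λ s → Transposable b s p₀) (sym (move-stays b 1 λ st → IsState.¬first st (refl , refl))) (transposable-refl b p₀)
transposable-move-p₀ b b≥1 2 =
  subst (λ s → Transposable b s p₀) (sym (move-first b 0 (s≤s (s≤s b≥1)))) (q₀⇄p₀ b b≥1)
transposable-move-p₀ b b≥1 (suc (suc (suc i))) =
  subst (λ s → Transposable b s p₀) (sym (move-moves b (3 + i) {0} {2} (IsState-first (s≤s (s≤s z≤n)) (s≤s (s≤s z≤n)))))
        (transposable-refl b p₀)

reachable-move : ∀ b i {s s'} → ∃[ w ] act b w p₀ ≡ s → move b i s ≡ s' → ∃[ w ] act b w p₀ ≡ s'
reachable-move b i (w , e) e' = i ∷ w , trans (cong (move b i) e) e'

reachable : ∀ b {x y} → Valid b ⟨ x , y ⟩ → ∃[ w ] act b w p₀ ≡ ⟨ x , y ⟩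
reachable b {0} {0} (valid ())
reachable b {0} {1} (valid ())
reachable b {0} {2} _ = [] , refl
reachable b {0} {suc (suc (suc y))} v = reachable-move b (2 + y) (reachable b v′) (move-first b y y≤)
  where
  y≤ = IsState.y≤ (valid⇒IsState b v)
  v′ = IsState⇒valid b (IsState-first (s≤s (s≤s z≤n)) (≤-trans (n≤1+n _) y≤))
reachable b {suc x} {y} v with valid⇒IsState b v | y ≟ x
... | st | yes refl = reachable-move b x (reachable b (IsState⇒valid b before)) (move-to b x (τ-left x) (τ-right x) st)
  where
  open IsState st
  before : IsState b x (suc x)
  before = record
    { x≤ = ≤-trans (n≤1+n _) x≤ ; y≥ = s≤s z≤n ; y≤ = ≤-trans x≤ (n≤1+n _) ; x≢y = λ e → 1+n≢n (sym e)
    ; ¬last = λ (e , _) → 1+n≰n (subst (λ z → suc z ≤ suc b) e x≤)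
    ; ¬first = λ (e , _) → n≮0 (subst (0 <_) e y≥) }
... | st | no y≢x =
  reachable-move b x (reachable b (IsState⇒valid b before)) (move-to b x (τ-left x) (τ-other y≢x (λ e → x≢y (sym e))) st)
  where
  open IsState st
  before : IsState b x y
  before = record
    { x≤ = ≤-trans (n≤1+n _) x≤ ; y≥ = y≥ ; y≤ = y≤ ; x≢y = λ e → y≢x (sym e)
    ; ¬last = λ (e , _) → 1+n≰n (subst (λ z → suc z ≤ suc b) e x≤)
    ; ¬first = λ (e₁ , e₂) → x≢y (trans (cong suc e₁) (sym e₂)) }

transposable-states : ∀ b → 1 ≤ b → ∀ {a c} → Valid b a → Valid b c → Transposable b a c
transposable-states b b≥1 = transposable-all b _ (transposable-move-p₀ b b≥1) (λ { ⟨ x , y ⟩ v → reachable b v })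

-- Decoding states into linear extensions

true≢false : true ≢ false
true≢false ()

indicator : Bool → ℕ
indicator true  = 1
indicator false = 0

≡ᵇ-refl : ∀ n → (n ≡ᵇ n) ≡ true
≡ᵇ-refl zero    = refl
≡ᵇ-refl (suc n) = ≡ᵇ-refl n

≡ᵇ-true⇒≡ : ∀ {m n} → (m ≡ᵇ n) ≡ true → m ≡ n
≡ᵇ-true⇒≡ {m} {n} e = ≡ᵇ⇒≡ m n (subst T (sym e) _)

≡⇒≡ᵇ-true : ∀ {m n} → m ≡ n → (m ≡ᵇ n) ≡ true
≡⇒≡ᵇ-true {m} refl = ≡ᵇ-refl m

≢⇒≡ᵇ-false : ∀ {m n} → m ≢ n → (m ≡ᵇ n) ≡ false
≢⇒≡ᵇ-false {zero}  {zero}  m≢n = ⊥-elim (m≢n refl)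
≢⇒≡ᵇ-false {zero}  {suc n} _   = refl
≢⇒≡ᵇ-false {suc m} {zero}  _   = refl
≢⇒≡ᵇ-false {suc m} {suc n} m≢n = ≢⇒≡ᵇ-false (λ e → m≢n (cong suc e))

indicator-<ᵇ-suc : ∀ x k → indicator (x <ᵇ suc k) ≡ indicator (x <ᵇ k) + indicator (x ≡ᵇ k)
indicator-<ᵇ-suc zero    zero    = refl
indicator-<ᵇ-suc zero    (suc k) = refl
indicator-<ᵇ-suc (suc x) zero    = refl
indicator-<ᵇ-suc (suc x) (suc k) = indicator-<ᵇ-suc x k

indicator-< : ∀ {x k} → x < k → indicator (x <ᵇ k) ≡ 1
indicator-< {x} {k} x<k with x <ᵇ k | <⇒<ᵇ x<k
... | true | _ = refl

indicator-≮ : ∀ {x k} → ¬ x < k → indicator (x <ᵇ k) ≡ 0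
indicator-≮ {x} {k} x≮k with x <ᵇ k in e
... | true  = ⊥-elim (x≮k (<ᵇ⇒< x k (subst T (sym e) _)))
... | false = refl

occupied : ℕ → ℕ → ℕ → Bool
occupied x y k = (k ≡ᵇ x) ∨ (k ≡ᵇ y)

occupied-left : ∀ x y → occupied x y x ≡ true
occupied-left x y rewrite ≡ᵇ-refl x = refl

occupied-right : ∀ x y → occupied x y y ≡ true
occupied-right x y rewrite ≡ᵇ-refl y with y ≡ᵇ x
... | true  = refl
... | false = refl

≢⇒unoccupied : ∀ {x y k} → k ≢ x → k ≢ y → occupied x y k ≡ false
≢⇒unoccupied k≢x k≢y rewrite ≢⇒≡ᵇ-false k≢x | ≢⇒≡ᵇ-false k≢y = refl

unoccupied⇒≢ : ∀ {x y k} → occupied x y k ≡ false → k ≢ x × k ≢ y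
unoccupied⇒≢ {x} {y} {k} e = (λ { refl → true≢false (trans (sym (occupied-left k y)) e) })
                      , (λ { refl → true≢false (trans (sym (occupied-right x k)) e) })

rank : ℕ → ℕ → ℕ → ℕ
rank x y zero    = 0
rank x y (suc k) = (if occupied x y k then 0 else 1) + rank x y k

rank-free : ∀ {x y j} → occupied x y j ≡ false → rank x y (suc j) ≡ suc (rank x y j)
rank-free e rewrite e = refl

rank-occupied : ∀ {x y j} → occupied x y j ≡ true → rank x y (suc j) ≡ rank x y j
rank-occupied e rewrite e = refl

rank-mono : ∀ x y {j k} → j ≤ k → rank x y j ≤ rank x y k
rank-mono x y {j} {k} j≤k with d , refl ← m≤n⇒∃[o]m+o≡n j≤k = go j d
  where
  go : ∀ j d → rank x y j ≤ rank x y (j + d)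
  go j zero    rewrite +-identityʳ j = ≤-refl
  go j (suc d) rewrite +-suc j d = ≤-trans (go j d) (m≤n+m (rank x y (j + d)) _)

rank-strict : ∀ x y {j k} → j < k → occupied x y j ≡ false → rank x y j < rank x y k
rank-strict x y {j} lt e = ≤-trans (≤-reflexive (sym (rank-free {x} {y} {j} e))) (rank-mono x y lt)

rank-closed : ∀ {x y} → x ≢ y → ∀ k → rank x y k + (indicator (x <ᵇ k) + indicator (y <ᵇ k)) ≡ k
rank-closed x≢y zero = refl
rank-closed {x} {y} x≢y (suc k) rewrite indicator-<ᵇ-suc x k | indicator-<ᵇ-suc y k = begin
    inc + rank x y k + (ι (x <ᵇ k) + ι (x ≡ᵇ k) + (ι (y <ᵇ k) + ι (y ≡ᵇ k)))
  ≡⟨ regroup inc (rank x y k) (ι (x <ᵇ k)) (ι (x ≡ᵇ k)) (ι (y <ᵇ k)) (ι (y ≡ᵇ k)) ⟩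
    (inc + (ι (x ≡ᵇ k) + ι (y ≡ᵇ k))) + (rank x y k + (ι (x <ᵇ k) + ι (y <ᵇ k)))
  ≡⟨ cong₂ _+_ step (rank-closed x≢y k) ⟩
    suc k
  ∎
  where
  open ≡-Reasoning
  ι = indicator
  inc = if occupied x y k then 0 else 1
  regroup : ∀ a c d e f g → a + c + (d + e + (f + g)) ≡ (a + (e + g)) + (c + (d + f))
  regroup = solve-∀
  step : inc + (ι (x ≡ᵇ k) + ι (y ≡ᵇ k)) ≡ 1
  step with k ≟ x | k ≟ y
  ... | yes refl | yes refl = ⊥-elim (x≢y refl)
  ... | yes refl | no k≢y rewrite ≡ᵇ-refl k | ≢⇒≡ᵇ-false (λ e → k≢y (sym e)) = refl
  ... | no k≢x | yes refl rewrite ≡ᵇ-refl k | ≢⇒≡ᵇ-false k≢x | ≢⇒≡ᵇ-false (λ e → k≢x (sym e)) = refl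
  ... | no k≢x | no k≢y
    rewrite ≢⇒≡ᵇ-false k≢x | ≢⇒≡ᵇ-false k≢y
          | ≢⇒≡ᵇ-false (λ e → k≢x (sym e)) | ≢⇒≡ᵇ-false (λ e → k≢y (sym e)) = refl

module RankFacts {b x y : ℕ} (st : IsState b x y) where
  open IsState st

  rank-total : rank x y (3 + b) ≡ suc b
  rank-total = +-cancelʳ-≡ 2 (rank x y (3 + b)) (suc b) (begin
    rank x y (3 + b) + 2                                              ≡⟨ cong (rank x y (3 + b) +_) two≡ ⟩
    rank x y (3 + b) + (indicator (x <ᵇ 3 + b) + indicator (y <ᵇ 3 + b)) ≡⟨ rank-closed x≢y (3 + b) ⟩
    3 + b                                                             ≡⟨ +-comm 2 (suc b) ⟩
    suc b + 2                                                         ∎)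
    where
    open ≡-Reasoning
    two≡ : 2 ≡ indicator (x <ᵇ 3 + b) + indicator (y <ᵇ 3 + b)
    two≡ = sym (cong₂ _+_ (indicator-< (s≤s (≤-trans x≤ (n≤1+n _)))) (indicator-< (s≤s y≤)))

  rank≤ : ∀ {k} → k ≤ suc (suc b) → occupied x y k ≡ false → rank x y k ≤ b
  rank≤ {k} k≤ e = ≤-pred (subst (rank x y k <_) rank-total (rank-strict x y (s≤s k≤) e))

  rank-at-x : rank x y x ≤ b
  rank-at-x with y <? x
  ... | yes y<x = ≤-pred (≤-trans (≤-reflexive (trans (+-comm 1 (rank x y x)) r+1≡x)) x≤)
    where
    r+1≡x : rank x y x + 1 ≡ x
    r+1≡x = trans (cong (rank x y x +_) (sym (cong₂ _+_ (indicator-≮ (n≮n x)) (indicator-< y<x)))) (rank-closed x≢y x)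
  ... | no y≮x = ≤-trans (≤-reflexive r≡x) x≤b
    where
    r≡x : rank x y x ≡ x
    r≡x = trans (sym (+-identityʳ _))
                (trans (cong (rank x y x +_) (sym (cong₂ _+_ (indicator-≮ (n≮n x)) (indicator-≮ y≮x)))) (rank-closed x≢y x))
    x≤b : x ≤ b
    x≤b with x ≟ suc b
    ... | no x≢sb = ≤-pred (≤∧≢⇒< x≤ x≢sb)
    ... | yes refl = ⊥-elim (¬last (refl , ≤-antisym y≤ (≤∧≢⇒< (≮⇒≥ y≮x) x≢y)))

  rank-at-y : 1 ≤ rank x y y
  rank-at-y with x <? y
  ... | yes x<y = ≤-pred (subst (2 ≤_) (sym (trans (+-comm 1 _) r+1≡y)) y≥2)
    where
    r+1≡y : rank x y y + 1 ≡ y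
    r+1≡y = trans (cong (rank x y y +_) (sym (cong₂ _+_ (indicator-< x<y) (indicator-≮ (n≮n y))))) (rank-closed x≢y y)
    y≥2 : 2 ≤ y
    y≥2 with y ≟ 1
    ... | yes refl = ⊥-elim (¬first (n<1⇒n≡0 x<y , refl))
    ... | no y≢1 = ≤∧≢⇒< y≥ (λ e → y≢1 (sym e))
  ... | no x≮y = subst (1 ≤_) (sym r≡y) y≥
    where
    r≡y : rank x y y ≡ y
    r≡y = trans (sym (+-identityʳ _))
                (trans (cong (rank x y y +_) (sym (cong₂ _+_ (indicator-≮ x≮y) (indicator-≮ (n≮n y))))) (rank-closed x≢y y))

-- The linear extension of a state: 0 at x, b+2 at y, and the chain b+1, b, …, 1
-- filling the remaining positions from left to right.
value : ℕ → State → ℕ → ℕ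
value b ⟨ x , y ⟩ k = if k ≡ᵇ x then 0 else if k ≡ᵇ y then suc (suc b) else suc b ∸ rank x y k

value-left : ∀ b x y → value b ⟨ x , y ⟩ x ≡ 0
value-left b x y rewrite ≡ᵇ-refl x = refl

value-right : ∀ b {x y} → x ≢ y → value b ⟨ x , y ⟩ y ≡ suc (suc b)
value-right b {x} {y} x≢y rewrite ≢⇒≡ᵇ-false (λ e → x≢y (sym e)) | ≡ᵇ-refl y = refl

value-free : ∀ b {x y k} → k ≢ x → k ≢ y → value b ⟨ x , y ⟩ k ≡ suc b ∸ rank x y k
value-free b k≢x k≢y rewrite ≢⇒≡ᵇ-false k≢x | ≢⇒≡ᵇ-false k≢y = refl

value≤ : ∀ b s k → value b s k ≤ suc (suc b)
value≤ b ⟨ x , y ⟩ k with k ≡ᵇ x | k ≡ᵇ y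
... | true  | _     = z≤n
... | false | true  = ≤-refl
... | false | false = ≤-trans (m∸n≤m (suc b) (rank x y k)) (n≤1+n _)

-- a clamp for the type checker: value never exceeds b+2
toElt : ∀ b → ℕ → Elt b
toElt b n with n ≤? suc (suc b)
... | yes n≤ = elt b n n≤
... | no _   = Fin.zero

toℕ-toElt : ∀ b {n} → n ≤ suc (suc b) → toℕ (toElt b n) ≡ n
toℕ-toElt b {n} n≤ with n ≤? suc (suc b)
... | yes n≤′ = toℕ-elt b n n≤′
... | no n≰   = ⊥-elim (n≰ n≤)

decode : ∀ b → State → Vec (Elt b) (suc (suc (b + 1)))
decode b s = tabulate (λ k → toElt b (value b s (toℕ k)))

lookup-decode : ∀ b s k → toℕ (lookup (decode b s) k) ≡ value b s (toℕ k)
lookup-decode b s k = trans (cong toℕ (lookup∘tabulate (λ k → toElt b (value b s (toℕ k))) k))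
                            (toℕ-toElt b (value≤ b s (toℕ k)))

chain-value≥1 : ∀ {b r} → r ≤ b → 1 ≤ suc b ∸ r
chain-value≥1 r≤b = subst (1 ≤_) (sym (+-∸-assoc 1 r≤b)) (s≤s z≤n)

module Slots {b x y : ℕ} (st : IsState b x y) where
  open IsState st
  open RankFacts st

  data Slot (k : ℕ) : Set where
    at-x     : k ≡ x → value b ⟨ x , y ⟩ k ≡ 0 → Slot k
    at-y     : k ≡ y → value b ⟨ x , y ⟩ k ≡ suc (suc b) → Slot k
    in-chain : occupied x y k ≡ false → value b ⟨ x , y ⟩ k ≡ suc b ∸ rank x y k → rank x y k ≤ b → Slot k

  slot : ∀ k → k ≤ suc (suc b) → Slot k
  slot k k≤ with k ≟ x | k ≟ y
  ... | yes refl | _        = at-x refl (value-left b k y)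
  ... | no _     | yes refl = at-y refl (value-right b x≢y)
  ... | no k≢x   | no k≢y   = in-chain (≢⇒unoccupied k≢x k≢y) (value-free b k≢x k≢y) (rank≤ k≤ (≢⇒unoccupied k≢x k≢y))

  rank-injective : ∀ {i j} → occupied x y i ≡ false → occupied x y j ≡ false → rank x y i ≡ rank x y j → i ≡ j
  rank-injective {i} {j} fi fj e with <-cmp i j
  ... | tri< i<j _ _ = ⊥-elim (<⇒≢ (rank-strict x y i<j fi) e)
  ... | tri≈ _ i≡j _ = i≡j
  ... | tri> _ _ j<i = ⊥-elim (<⇒≢ (rank-strict x y j<i fj) (sym e))

  value-injective : ∀ {i j} → i ≤ suc (suc b) → j ≤ suc (suc b) → value b ⟨ x , y ⟩ i ≡ value b ⟨ x , y ⟩ j → i ≡ j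
  value-injective {i} {j} i≤ j≤ e with slot i i≤ | slot j j≤
  ... | at-x refl _    | at-x refl _    = refl
  ... | at-y refl _    | at-y refl _    = refl
  ... | at-x _ vi      | at-y _ vj      = ⊥-elim (0≢1+n (trans (sym vi) (trans e vj)))
  ... | at-y _ vi      | at-x _ vj      = ⊥-elim (0≢1+n (trans (sym vj) (trans (sym e) vi)))
  ... | at-x _ vi      | in-chain _ vj rj = ⊥-elim (<⇒≱ (chain-value≥1 rj) (≤-reflexive (trans (sym vj) (trans (sym e) vi))))
  ... | in-chain _ vi ri | at-x _ vj    = ⊥-elim (<⇒≱ (chain-value≥1 ri) (≤-reflexive (trans (sym vi) (trans e vj))))
  ... | at-y _ vi      | in-chain _ vj _ =
    ⊥-elim (1+n≰n (≤-trans (≤-reflexive (trans (sym vi) (trans e vj))) (m∸n≤m (suc b) (rank x y j))))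
  ... | in-chain _ vi _ | at-y _ vj     =
    ⊥-elim (1+n≰n (≤-trans (≤-reflexive (trans (sym vj) (trans (sym e) vi))) (m∸n≤m (suc b) (rank x y i))))
  ... | in-chain fi vi ri | in-chain fj vj rj =
    rank-injective fi fj (∸-cancelˡ-≡ (≤-trans ri (n≤1+n b)) (≤-trans rj (n≤1+n b)) (trans (sym vi) (trans e vj)))

  value≡0 : ∀ {k} → k ≤ suc (suc b) → value b ⟨ x , y ⟩ k ≡ 0 → k ≡ x
  value≡0 {k} k≤ v≡0 with slot k k≤
  ... | at-x k≡x _       = k≡x
  ... | at-y _ vk        = ⊥-elim (0≢1+n (trans (sym v≡0) vk))
  ... | in-chain _ vk rk = ⊥-elim (<⇒≱ (chain-value≥1 rk) (≤-reflexive (trans (sym vk) v≡0)))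

  value≡top : ∀ {k} → k ≤ suc (suc b) → value b ⟨ x , y ⟩ k ≡ suc (suc b) → k ≡ y
  value≡top {k} k≤ v≡ssb with slot k k≤
  ... | at-x _ vk        = ⊥-elim (0≢1+n (trans (sym vk) v≡ssb))
  ... | at-y k≡y _       = k≡y
  ... | in-chain _ vk _  = ⊥-elim (1+n≰n (≤-trans (≤-reflexive (trans (sym v≡ssb) vk)) (m∸n≤m (suc b) (rank x y k))))

  value-chain : ∀ {k} → k ≤ suc (suc b) → 1 ≤ value b ⟨ x , y ⟩ k → value b ⟨ x , y ⟩ k ≤ suc b →
                occupied x y k ≡ false × rank x y k ≡ suc b ∸ value b ⟨ x , y ⟩ k
  value-chain {k} k≤ v≥1 v≤sb with slot k k≤
  ... | at-x _ vk         = ⊥-elim (<⇒≱ v≥1 (≤-reflexive vk))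
  ... | at-y _ vk         = ⊥-elim (1+n≰n (subst (_≤ suc b) vk v≤sb))
  ... | in-chain fk vk rk = fk , sym (trans (cong (suc b ∸_) vk) (m∸[m∸n]≡n (≤-trans rk (n≤1+n b))))

  value-ordered : ∀ {i j} → i ≤ suc (suc b) → j ≤ suc (suc b) →
                  Below b (value b ⟨ x , y ⟩ i) (value b ⟨ x , y ⟩ j) → i < j
  value-ordered {i} {j} i≤ j≤ (inj₁ (vi≡0 , vj≡1)) with refl ← value≡0 i≤ vi≡0 = ≰⇒> j≰x
    where
    j≰x : ¬ j ≤ x
    j≰x j≤x with fj , rj ← value-chain j≤ (≤-reflexive (sym vj≡1)) (subst (_≤ suc b) (sym vj≡1) (s≤s z≤n)) =
      <⇒≱ (≤-trans (rank-strict x y (≤∧≢⇒< j≤x (proj₁ (unoccupied⇒≢ fj))) fj) rank-at-x)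
          (≤-reflexive (trans (cong (suc b ∸_) (sym vj≡1)) (sym rj)))
  value-ordered {i} {j} i≤ j≤ (inj₂ (inj₁ (vi≡sb , vj≡ssb))) with refl ← value≡top j≤ vj≡ssb = ≰⇒> y≰i
    where
    y≰i : ¬ y ≤ i
    y≰i y≤i with _ , ri ← value-chain i≤ (subst (1 ≤_) (sym vi≡sb) (s≤s z≤n)) (≤-reflexive vi≡sb) =
      <⇒≱ rank-at-y (≤-trans (rank-mono x y y≤i)
                              (≤-reflexive (trans ri (trans (cong (suc b ∸_) vi≡sb) (n∸n≡0 (suc b))))))
  value-ordered {i} {j} i≤ j≤ (inj₂ (inj₂ (vj≥1 , vj<vi , vi≤sb)))
    with _ , ri ← value-chain i≤ (≤-trans vj≥1 (<⇒≤ vj<vi)) vi≤sb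
       | _ , rj ← value-chain j≤ vj≥1 (≤-trans (<⇒≤ vj<vi) vi≤sb) =
    ≰⇒> λ j≤i → <⇒≱ ri<rj (rank-mono x y j≤i)
    where
    ri<rj : rank x y i < rank x y j
    ri<rj = subst₂ _<_ (sym ri) (sym rj) (∸-monoʳ-< vj<vi vi≤sb)

decode-isLinExt : ∀ b → 1 ≤ b → ∀ {x y} → IsState b x y → IsLinExt (N< 1 b 1) (decode b ⟨ x , y ⟩)
decode-isLinExt b b≥1 {x} {y} st = record { covers = distinct⇒covers p distinct ; distinct = distinct ; ordered = ordered }
  where
  open Slots st
  p = decode b ⟨ x , y ⟩
  distinct : ∀ i j → lookup p i ≡ lookup p j → i ≡ j
  distinct i j e = toℕ-injective (value-injective (toℕ≤ b i) (toℕ≤ b j)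
    (trans (sym (lookup-decode b _ i)) (trans (cong toℕ e) (lookup-decode b _ j))))
  ordered : ∀ i j → N< 1 b 1 (lookup p i) (lookup p j) → i Fin.< j
  ordered i j r = value-ordered (toℕ≤ b i) (toℕ≤ b j)
    (subst₂ (Below b) (lookup-decode b _ i) (lookup-decode b _ j) (N<⇒Below b b≥1 _ _ r))

chain-comparable : ∀ b (u v : Elt b) → 1 ≤ toℕ u → toℕ u ≤ suc b → 1 ≤ toℕ v → toℕ v ≤ suc b →
                   Comparable (N< 1 b 1) u v
chain-comparable b u v u≥1 u≤ v≥1 v≤ with <-cmp (toℕ u) (toℕ v)
... | tri< u<v _ _ = inj₂ (inj₂ (Below⇒N< b v u (inj₂ (inj₂ (u≥1 , u<v , v≤)))))
... | tri≈ _ u≡v _ = inj₁ (toℕ-injective u≡v)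
... | tri> _ _ v<u = inj₂ (inj₁ (Below⇒N< b u v (inj₂ (inj₂ (v≥1 , v<u , u≤)))))

module _ (b : ℕ) {q : Vec (Elt b) (suc (suc (b + 1)))} (le : IsLinExt (N< 1 b 1) q) where
  open IsLinExt le

  private
    entry : ∀ n → n ≤ suc (suc b) → ∃[ k ] toℕ (lookup q k) ≡ n
    entry n n≤ with k , qk ← position (covers (elt b n n≤)) = k , trans (cong toℕ qk) (toℕ-elt b n n≤)

    precedes : ∀ i j → Below b (toℕ (lookup q i)) (toℕ (lookup q j)) → toℕ i < toℕ j
    precedes i j r = ordered i j (Below⇒N< b _ _ r)

    same-entry : ∀ i j → toℕ (lookup q i) ≡ toℕ (lookup q j) → i ≡ j
    same-entry i j e = distinct i j (toℕ-injective e)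

  linExt-IsState : ∀ X Y → toℕ (lookup q X) ≡ 0 → toℕ (lookup q Y) ≡ suc (suc b) → IsState b (toℕ X) (toℕ Y)
  linExt-IsState X Y qX qY with J₁ , qJ₁ ← entry 1 (s≤s z≤n) | Jsb , qJsb ← entry (suc b) (n≤1+n _) = record
    { x≤ = ≤-pred (≤-trans X<J₁ (toℕ≤ b J₁))
    ; y≥ = ≤-trans (s≤s z≤n) Jsb<Y
    ; y≤ = toℕ≤ b Y
    ; x≢y = λ e → 0≢1+n (trans (sym qX) (trans (cong (λ k → toℕ (lookup q k)) (toℕ-injective e)) qY))
    ; ¬last = λ (eX , eY) →
        let J₁≡Y = toℕ-injective (trans (≤-antisym (toℕ≤ b J₁) (subst (_< toℕ J₁) eX X<J₁)) (sym eY))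
        in 1+n≢0 (suc-injective (trans (sym qY) (trans (cong (λ k → toℕ (lookup q k)) (sym J₁≡Y)) qJ₁)))
    ; ¬first = λ (eX , eY) →
        let Jsb≡X = toℕ-injective (trans (n<1⇒n≡0 (subst (toℕ Jsb <_) eY Jsb<Y)) (sym eX))
        in 1+n≢0 (trans (sym qJsb) (trans (cong (λ k → toℕ (lookup q k)) Jsb≡X) qX))
    }
    where
    X<J₁ = precedes X J₁ (inj₁ (qX , qJ₁))
    Jsb<Y = precedes Jsb Y (inj₂ (inj₁ (qJsb , qY)))

  pos₀ posTop : ℕ
  pos₀ = toℕ (proj₁ (entry 0 z≤n))
  posTop = toℕ (proj₁ (entry (suc (suc b)) ≤-refl))

  encode : State
  encode = ⟨ pos₀ , posTop ⟩

  encode-IsState : IsState b pos₀ posTop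
  encode-IsState = linExt-IsState _ _ (proj₂ (entry 0 z≤n)) (proj₂ (entry (suc (suc b)) ≤-refl))

  linExt≡decode : 1 ≤ b → q ≡ decode b encode
  linExt≡decode b≥1 = linExt-unique le (decode-isLinExt b b≥1 encode-IsState) comparable
    where
    X = proj₁ (entry 0 z≤n)
    Y = proj₁ (entry (suc (suc b)) ≤-refl)
    qX = proj₂ (entry 0 z≤n)
    qY = proj₂ (entry (suc (suc b)) ≤-refl)
    open Slots encode-IsState
    comparable : ∀ k → Comparable (N< 1 b 1) (lookup q k) (lookup (decode b encode) k)
    comparable k with slot (toℕ k) (toℕ≤ b k)
    ... | at-x k≡X vk = inj₁ (toℕ-injective (trans (cong (λ j → toℕ (lookup q j)) (toℕ-injective k≡X))
                                            (trans qX (sym (trans (lookup-decode b encode k) vk)))))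
    ... | at-y k≡Y vk = inj₁ (toℕ-injective (trans (cong (λ j → toℕ (lookup q j)) (toℕ-injective k≡Y))
                                            (trans qY (sym (trans (lookup-decode b encode k) vk)))))
    ... | in-chain fk vk rk with k≢X , k≢Y ← unoccupied⇒≢ fk =
      chain-comparable b _ _ (n≢0⇒n>0 qk≢0) (≤-pred (≤∧≢⇒< (toℕ≤ b (lookup q k)) qk≢ssb))
        (subst (1 ≤_) (sym dk) (chain-value≥1 rk)) (subst (_≤ suc b) (sym dk) (m∸n≤m (suc b) (rank pos₀ posTop (toℕ k))))
      where
      qk≢0 : toℕ (lookup q k) ≢ 0
      qk≢0 e = k≢X (cong toℕ (same-entry k X (trans e (sym qX))))
      qk≢ssb : toℕ (lookup q k) ≢ suc (suc b)
      qk≢ssb e = k≢Y (cong toℕ (same-entry k Y (trans e (sym qY))))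
      dk = trans (lookup-decode b encode k) vk

value-via-decode : ∀ b s {k} (k≤ : k ≤ suc (suc b)) → toℕ (lookup (decode b s) (elt b k k≤)) ≡ value b s k
value-via-decode b s {k} k≤ = trans (lookup-decode b s (elt b k k≤)) (cong (value b s) (toℕ-elt b _ k≤))

decode-linExt⇒IsState : ∀ b {x y} → x ≤ suc (suc b) → y ≤ suc (suc b) → x ≢ y →
                        IsLinExt (N< 1 b 1) (decode b ⟨ x , y ⟩) → IsState b x y
decode-linExt⇒IsState b {x} {y} x≤ y≤ x≢y le =
  subst₂ (IsState b) (toℕ-elt b x x≤) (toℕ-elt b y y≤)
    (linExt-IsState b le (elt b x x≤) (elt b y y≤)
      (trans (value-via-decode b ⟨ x , y ⟩ x≤) (value-left b x y))
      (trans (value-via-decode b ⟨ x , y ⟩ y≤) (value-right b x≢y)))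

decode-injective : ∀ b {s s'} → Valid b s → Valid b s' → decode b s ≡ decode b s' → s ≡ s'
decode-injective b {⟨ x , y ⟩} {⟨ x' , y' ⟩} v v' e =
  state-cong (value≡0 x≤ (trans (sym (same-value x≤)) (value-left b x y)))
            (value≡top y≤ (trans (sym (same-value y≤)) (value-right b (IsState.x≢y (valid⇒IsState b v)))))
  where
  open Slots (valid⇒IsState b v')
  x≤ = proj₁ (valid⇒bounded b v)
  y≤ = proj₂ (valid⇒bounded b v)
  same-value : ∀ {k} (k≤ : k ≤ suc (suc b)) → value b ⟨ x , y ⟩ k ≡ value b ⟨ x' , y' ⟩ k
  same-value k≤ = trans (sym (value-via-decode b ⟨ x , y ⟩ k≤))
                        (trans (cong (λ p → toℕ (lookup p (elt b _ k≤))) e) (value-via-decode b ⟨ x' , y' ⟩ k≤))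

-- Moves are Bender–Knuth moves

≡ᵇ-τ : ∀ I k x → (k ≡ᵇ τ I x) ≡ (τ I k ≡ᵇ x)
≡ᵇ-τ I k x with k ≡ᵇ τ I x in e | τ I k ≡ᵇ x in e′
... | true  | true  = refl
... | false | false = refl
... | true  | false = ⊥-elim (true≢false (trans (sym (≡⇒≡ᵇ-true τk≡x)) e′))
  where τk≡x = trans (cong (τ I) (≡ᵇ-true⇒≡ e)) (τ-involutive I x)
... | false | true  = ⊥-elim (true≢false (trans (sym (≡⇒≡ᵇ-true k≡τx)) e))
  where k≡τx = trans (sym (τ-involutive I k)) (cong (τ I) (≡ᵇ-true⇒≡ e′))

occupied-τ : ∀ I x y k → occupied (τ I x) (τ I y) k ≡ occupied x y (τ I k)
occupied-τ I x y k rewrite ≡ᵇ-τ I k x | ≡ᵇ-τ I k y = refl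

-- Only the count below I+1 sees the two swapped positions separately.
rank-τ : ∀ I x y k → k ≢ suc I → rank (τ I x) (τ I y) k ≡ rank x y k
rank-τ I x y zero    _      = refl
rank-τ I x y (suc j) sj≢sI with τ-view I j
... | left = ⊥-elim (sj≢sI refl)
... | right rewrite occupied-τ I x y (suc I) | occupied-τ I x y I | τ-right I | τ-left I
                  | rank-τ I x y I (λ e → 1+n≢n (sym e)) = swap-sum (inc I) (inc (suc I)) (rank x y I)
  where
  inc = λ k → if occupied x y k then 0 else 1
  swap-sum : ∀ a c d → a + (c + d) ≡ c + (a + d)
  swap-sum = solve-∀
... | other j≢I j≢sI rewrite occupied-τ I x y j | τ-other j≢I j≢sI = cong (_ +_) (rank-τ I x y j j≢sI)

move-away : ∀ b I {x y} → IsState b x y → occupied x y I ≡ false → occupied x y (suc I) ≡ false →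
            move b I ⟨ x , y ⟩ ≡ ⟨ x , y ⟩
move-away b I {x} {y} st fI fsI =
  move-to b I (τ-other (≢-sym (proj₁ I-free)) (≢-sym (proj₁ sI-free)))
              (τ-other (≢-sym (proj₂ I-free)) (≢-sym (proj₂ sI-free))) st
  where
  I-free = unoccupied⇒≢ {x} {y} fI
  sI-free = unoccupied⇒≢ {x} {y} fsI

WindowMeets : ℕ → ℕ → ℕ → Set
WindowMeets x y I = occupied x y I ≡ true ⊎ occupied x y (suc I) ≡ true

value-τ : ∀ b I {x y} → WindowMeets x y I → ∀ k → value b ⟨ τ I x , τ I y ⟩ k ≡ value b ⟨ x , y ⟩ (τ I k)
value-τ b I {x} {y} meets k rewrite ≡ᵇ-τ I k x | ≡ᵇ-τ I k y with τ I k ≡ᵇ x in ex | τ I k ≡ᵇ y in ey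
... | true  | _     = refl
... | false | true  = refl
... | false | false = cong (suc b ∸_) (rank-window meets (τ-view I k))
  where
  τk-free : occupied x y (τ I k) ≡ false
  τk-free rewrite ex | ey = refl
  rank-window : WindowMeets x y I → TauView I k → rank (τ I x) (τ I y) k ≡ rank x y (τ I k)
  rank-window (inj₁ I-occ) left =
    trans (rank-τ I x y I (λ e → 1+n≢n (sym e)))
          (trans (sym (rank-occupied {x} {y} {I} I-occ)) (cong (rank x y) (sym (τ-left I))))
  rank-window (inj₂ sI-occ) left =
    ⊥-elim (true≢false (trans (sym sI-occ) (trans (cong (occupied x y) (sym (τ-left I))) τk-free)))
  rank-window (inj₁ I-occ) right =
    ⊥-elim (true≢false (trans (sym I-occ) (trans (cong (occupied x y) (sym (τ-right I))) τk-free)))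
  rank-window (inj₂ sI-occ) right rewrite occupied-τ I x y I | τ-left I | sI-occ | τ-right I =
    rank-τ I x y I (λ e → 1+n≢n (sym e))
  rank-window _ (other k≢I k≢sI) = trans (rank-τ I x y k k≢sI) (cong (rank x y) (sym (τ-other k≢I k≢sI)))

module _ (b : ℕ) (i : Fin (suc (b + 1))) where

  private
    L = inject₁ i
    R = Fin.suc i
    I = toℕ i

  decode-τ : ∀ {x y} → WindowMeets x y I → swap (decode b ⟨ x , y ⟩) L R ≡ decode b ⟨ τ I x , τ I y ⟩
  decode-τ {x} {y} meets = vec-ext λ k → toℕ-injective (step k)
    where
    step : ∀ k → toℕ (lookup (swap (decode b ⟨ x , y ⟩) L R) k) ≡ toℕ (lookup (decode b ⟨ τ I x , τ I y ⟩) k)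
    step k with k' , tk , qk ← swap-adjacent-lookup (decode b ⟨ x , y ⟩) i k = begin
      toℕ (lookup (swap (decode b ⟨ x , y ⟩) L R) k)  ≡⟨ cong toℕ qk ⟩
      toℕ (lookup (decode b ⟨ x , y ⟩) k')             ≡⟨ lookup-decode b ⟨ x , y ⟩ k' ⟩
      value b ⟨ x , y ⟩ (toℕ k')                       ≡⟨ cong (value b ⟨ x , y ⟩) tk ⟩
      value b ⟨ x , y ⟩ (τ I (toℕ k))                  ≡⟨ sym (value-τ b I meets (toℕ k)) ⟩
      value b ⟨ τ I x , τ I y ⟩ (toℕ k)                ≡⟨ sym (lookup-decode b _ k) ⟩
      toℕ (lookup (decode b ⟨ τ I x , τ I y ⟩) k)      ∎
      where open ≡-Reasoning

  I≤ : I ≤ suc b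
  I≤ = subst (I ≤_) (+-comm b 1) (≤-pred (toℕ<n i))

  module _ (b≥1 : 1 ≤ b) where
    open BenderKnuth (comparable? b b≥1)

    decode-move-free : ∀ {x y} → Valid b ⟨ x , y ⟩ → occupied x y I ≡ false → occupied x y (suc I) ≡ false →
                       bkMove i (decode b ⟨ x , y ⟩) ≡ decode b (move b I ⟨ x , y ⟩)
    decode-move-free {x} {y} v fI fsI = trans (bkMove-fixed i le not-swappable) (cong (decode b) (sym (move-away b I st fI fsI)))
      where
      st = valid⇒IsState b v
      le = decode-isLinExt b b≥1 st
      open Slots st
      chain-entry : ∀ {k} → occupied x y k ≡ false → k ≤ suc (suc b) → ∀ K → toℕ K ≡ k →
                    1 ≤ toℕ (lookup (decode b ⟨ x , y ⟩) K) × toℕ (lookup (decode b ⟨ x , y ⟩) K) ≤ suc b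
      chain-entry {k} fk k≤ K refl with slot k k≤
      ... | at-x k≡x _ = ⊥-elim (proj₁ (unoccupied⇒≢ {x} {y} fk) k≡x)
      ... | at-y k≡y _ = ⊥-elim (proj₂ (unoccupied⇒≢ {x} {y} fk) k≡y)
      ... | in-chain _ vk rk = subst (1 ≤_) (sym dk) (chain-value≥1 rk) , subst (_≤ suc b) (sym dk) (m∸n≤m (suc b) (rank x y k))
        where dk = trans (lookup-decode b ⟨ x , y ⟩ K) vk
      not-swappable : ¬ IsLinExt (N< 1 b 1) (swap (decode b ⟨ x , y ⟩) L R)
      not-swappable le′ with eL≥1 , eL≤ ← chain-entry fI (≤-trans I≤ (n≤1+n _)) L (toℕ-inject₁ i)
                         | eR≥1 , eR≤ ← chain-entry fsI (s≤s I≤) R refl =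
        swap-isLinExt⇒incomparable i le le′ (chain-comparable b _ _ eL≥1 eL≤ eR≥1 eR≤)

    decode-move-meets : ∀ {x y} → Valid b ⟨ x , y ⟩ → WindowMeets x y I →
                        bkMove i (decode b ⟨ x , y ⟩) ≡ decode b (move b I ⟨ x , y ⟩)
    decode-move-meets {x} {y} v meets = by-cases (isState? b (τ I x) (τ I y))
      where
      st = valid⇒IsState b v
      le = decode-isLinExt b b≥1 st
      x≤ = proj₁ (valid⇒bounded b v)
      y≤ = proj₂ (valid⇒bounded b v)
      by-cases : Dec (IsState b (τ I x) (τ I y)) → bkMove i (decode b ⟨ x , y ⟩) ≡ decode b (move b I ⟨ x , y ⟩)
      by-cases (yes st′) =
        trans (bkMove-swapped i le (subst (IsLinExt (N< 1 b 1)) (sym (decode-τ meets)) (decode-isLinExt b b≥1 st′)))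
              (trans (decode-τ meets) (cong (decode b) (sym (move-moves b I st′))))
      by-cases (no ¬st′) =
        trans (bkMove-fixed i le λ le′ →
                 ¬st′ (decode-linExt⇒IsState b (τ-bounded b I≤ x≤) (τ-bounded b I≤ y≤)
                                             (λ e → IsState.x≢y st (τ-injective I e))
                                             (subst (IsLinExt (N< 1 b 1)) (decode-τ meets) le′)))
              (cong (decode b) (sym (move-stays b I ¬st′)))

    decode-move : ∀ {s} → Valid b s → bkMove i (decode b s) ≡ decode b (move b I s)
    decode-move {⟨ x , y ⟩} v = by-window (occupied x y I) refl (occupied x y (suc I)) refl
      where
      by-window : ∀ o → occupied x y I ≡ o → ∀ o′ → occupied x y (suc I) ≡ o′ →
                  bkMove i (decode b ⟨ x , y ⟩) ≡ decode b (move b I ⟨ x , y ⟩)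
      by-window false fI false fsI = decode-move-free {x} {y} v fI fsI
      by-window true  oI _     _   = decode-move-meets {x} {y} v (inj₁ oI)
      by-window false _  true osI  = decode-move-meets {x} {y} v (inj₂ osI)

-- LE-symmetry

generators : ∀ b → List ℕ → List (Fin (suc (b + 1)))
generators b []      = []
generators b (i ∷ w) with i <? suc (b + 1)
... | yes i< = fromℕ< i< ∷ generators b w
... | no _   = generators b w

module _ (b : ℕ) (b≥1 : 1 ≤ b) where
  open BenderKnuth (comparable? b b≥1)

  bkAct-decode : ∀ w s → Valid b s → bkAct (generators b w) (decode b s) ≡ decode b (act b w s)
  bkAct-decode []      s v = refl
  bkAct-decode (i ∷ w) s v with i <? suc (b + 1)
  ... | yes i< = begin
    bkMove (fromℕ< i<) (bkAct (generators b w) (decode b s))  ≡⟨ cong (bkMove (fromℕ< i<)) (bkAct-decode w s v) ⟩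
    bkMove (fromℕ< i<) (decode b (act b w s))                 ≡⟨ decode-move b (fromℕ< i<) b≥1 {act b w s} (act-valid b w v) ⟩
    decode b (move b (toℕ (fromℕ< i<)) (act b w s))          ≡⟨ cong (λ j → decode b (move b j (act b w s))) (toℕ-fromℕ< i<) ⟩
    decode b (move b i (act b w s))                          ∎
    where open ≡-Reasoning
  ... | no i≮ = begin
    bkAct (generators b w) (decode b s)  ≡⟨ bkAct-decode w s v ⟩
    decode b (act b w s)                 ≡⟨ cong (decode b) (sym (move-out-of-range b i {act b w s} i>sb (act-valid b w v))) ⟩
    decode b (move b i (act b w s))      ∎
    where
    open ≡-Reasoning
    i>sb : suc b < i
    i>sb = subst (_< i) (+-comm b 1) (≮⇒≥ i≮)

  linExt : ∀ s → Valid b s → LinExt (N< 1 b 1)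
  linExt ⟨ x , y ⟩ v = decode b ⟨ x , y ⟩ , decode-isLinExt b b≥1 (valid⇒IsState b v)

  linExt-vector : ∀ s v → proj₁ (linExt s v) ≡ decode b s
  linExt-vector ⟨ x , y ⟩ v = refl

  code : LinExt (N< 1 b 1) → State
  code (_ , le) = encode b le

  code-valid : ∀ L → Valid b (code L)
  code-valid (_ , le) = IsState⇒valid b (encode-IsState b le)

  decode-code : ∀ L → decode b (code L) ≡ proj₁ L
  decode-code (_ , le) = sym (linExt≡decode b le b≥1)

  -- σ may depend on the proof component of a linear extension, so the state reached
  -- by w from code L is identified through the injectivity of σ alone.
  realize-permutation : (σ : LinExt (N< 1 b 1) → LinExt (N< 1 b 1)) → IsPermLE (N< 1 b 1) σ →
                        ∃[ w ] ∀ L → act b w (code L) ≡ code (σ L)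
  realize-permutation σ (σ-injective , _) = w , realizes
    where
    f : ∀ s → Valid b s → State
    f s v = code (σ (linExt s v))
    decode-f : ∀ s v → decode b (f s v) ≡ proj₁ (σ (linExt s v))
    decode-f s v = decode-code (σ (linExt s v))
    f-injective : ∀ {s s'} v v' → f s v ≡ f s' v' → s ≡ s'
    f-injective {s} {s'} v v' e = decode-injective b v v' (begin
      decode b s            ≡⟨ sym (linExt-vector s v) ⟩
      proj₁ (linExt s v)    ≡⟨ σ-injective (linExt s v) (linExt s' v') σ-agree ⟩
      proj₁ (linExt s' v')  ≡⟨ linExt-vector s' v' ⟩
      decode b s'           ∎)
      where
      open ≡-Reasoning
      σ-agree = trans (sym (decode-f s v)) (trans (cong (decode b) e) (decode-f s' v'))
    found = realize-on b (valid? b) (valid-irrelevant b) (transposable-states b b≥1)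
                       f (λ s v → code-valid (σ (linExt s v))) f-injective (states b)
    w : List ℕ
    w = proj₁ found
    act-w : ∀ s (v : Valid b s) → act b w s ≡ f s v
    act-w s v = proj₂ found s (states-complete b v) v
    realizes : ∀ L → act b w (code L) ≡ code (σ L)
    realizes L = trans (cong (act b w) (sym s′≡codeL)) back
      where
      s′ = act b (reverse w) (code (σ L))
      v′ = act-valid b (reverse w) (code-valid (σ L))
      back : act b w s′ ≡ code (σ L)
      back = act-reverse b w (code-valid (σ L))
      s′≡codeL : s′ ≡ code L
      s′≡codeL = decode-injective b v′ (code-valid L) (begin
        decode b s′             ≡⟨ sym (linExt-vector s′ v′) ⟩
        proj₁ (linExt s′ v′)    ≡⟨ σ-injective (linExt s′ v′) L σ-agree ⟩
        proj₁ L                 ≡⟨ sym (decode-code L) ⟩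
        decode b (code L)       ∎)
        where
        open ≡-Reasoning
        σ-agree = trans (sym (decode-f s′ v′)) (trans (cong (decode b) (trans (sym (act-w s′ v′)) back)) (decode-code (σ L)))

  bkAct-permutation : (σ : LinExt (N< 1 b 1) → LinExt (N< 1 b 1)) → IsPermLE (N< 1 b 1) σ →
                      ∃[ ws ] ∀ L → bkAct ws (proj₁ L) ≡ proj₁ (σ L)
  bkAct-permutation σ σ-perm = generators b w , moves
    where
    w : List ℕ
    w = proj₁ (realize-permutation σ σ-perm)
    realizes : ∀ L → act b w (code L) ≡ code (σ L)
    realizes = proj₂ (realize-permutation σ σ-perm)
    moves : ∀ L → bkAct (generators b w) (proj₁ L) ≡ proj₁ (σ L)
    moves L = begin
      bkAct (generators b w) (proj₁ L)           ≡⟨ cong (bkAct (generators b w)) (sym (decode-code L)) ⟩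
      bkAct (generators b w) (decode b (code L)) ≡⟨ bkAct-decode w (code L) (code-valid L) ⟩
      decode b (act b w (code L))                ≡⟨ cong (decode b) (realizes L) ⟩
      decode b (code (σ L))                      ≡⟨ decode-code (σ L) ⟩
      proj₁ (σ L)                                ∎
      where open ≡-Reasoning

proposition4p15 : (b : ℕ) → 1 ≤ b → LESymmetric (N< 1 b 1)
proposition4p15 b b≥1 σ σ-perm = ws , λ L → subst (BKWord (N< 1 b 1) ws (proj₁ L)) (realizes L) (bkAct-BKWord ws (proj₁ L))
  where
  open BenderKnuth (comparable? b b≥1)
  ws : List (Fin (suc (b + 1)))
  ws = proj₁ (bkAct-permutation b b≥1 σ σ-perm)
  realizes : ∀ L → bkAct ws (proj₁ L) ≡ proj₁ (σ L)
  realizes = proj₂ (bkAct-permutation b b≥1 σ σ-perm)
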